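{- Let $n$ be even and let $\pi$ be a fixed-point-free involution of $[n]$ chosen uniformly at random; let $G_\pi$ be the directed graph on $[n]$ consisting of the 2-cycles $\{i,\pi(i)\}$ together with a self loop at every vertex, with all edges labeled by distinct non-commuting variables. Then with probability at least $1-1/\sqrt{n}$, every non-commutative algebraic branching program computing the Cayley permanent of $G_\pi$ has size $2^{\Omega(n)}$.
   Context: Polynomials live in the free non-commutative algebra over a field $\mathbb{K}$. A non-commutative algebraic branching program is a directed acyclic graph with distinguished nodes $s,t$, edges labeled by variables or constants, computing the sum over all $s\leadsto t$ paths of the product of labels in path order; size is the number of nodes. The Cayley permanent of $G_\pi$ is $\sum_{\sigma\in S_n}x_{1,\sigma(1)}\cdots x_{n,\sigma(n)}$ (product in this order), where $x_{i,j}$ is the label of edge $(i,j)$ and $0$ if absent. -}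

module Defs where

open import Level using (Level; _⊔_)
open import Algebra.Bundles using (CommutativeRing)
open import Data.Nat as ℕ using (ℕ; zero; suc; _<_)
open import Data.Fin as Fin using (Fin; toℕ)
open import Data.Fin.Properties using () renaming (_≟_ to _≟ᶠ_)
open import Data.Bool using (Bool; true; false; _∧_; if_then_else_)
open import Data.Product using (Σ; _×_; _,_; ∃)
open import Data.Sum using (_⊎_; inj₁; inj₂)
open import Data.List as List using (List; []; _∷_; length; allFin; concatMap; filter)
open import Data.Vec as Vec using (Vec; []; _∷_; lookup)
open import Relation.Nullary using (¬_; Dec; yes; no; does)
open import Relation.Nullary.Decidable using (⌊_⌋)
open import Relation.Binary.PropositionalEquality using (_≡_)
open import Function.Definitions using (Injective)
open import Data.List.Relation.Unary.All using (All)
open import Relation.Binary.Definitions using (DecidableEquality)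
open import Data.Product using (proj₁; proj₂)
open import Data.Fin.Properties using (all?)

record Field (c ℓ : Level) : Set (Level.suc (c ⊔ ℓ)) where
  field
    commRing : CommutativeRing c ℓ
  open CommutativeRing commRing public
  field
    1≉0     : ¬ (1# ≈ 0#)
    inverse : ∀ x → ¬ (x ≈ 0#) → Σ Carrier λ y → (x * y) ≈ 1#

IsFPFInvolution : ∀ {n} → Vec (Fin n) n → Set
IsFPFInvolution {n} π =
  (∀ i → lookup π (lookup π i) ≡ i) × (∀ i → ¬ (lookup π i ≡ i))

isFPFInvolution? : ∀ {n} (π : Vec (Fin n) n) → Dec (IsFPFInvolution π)
isFPFInvolution? π with all? (λ i → lookup π (lookup π i) ≟ᶠ i)
                      | all? (λ i → Relation.Nullary.¬? (lookup π i ≟ᶠ i))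
  where open import Relation.Nullary using (¬?)
... | yes p | yes q = yes (p , q)
... | no ¬p | _     = no λ { (p , q) → ¬p p }
... | yes _ | no ¬q = no λ { (p , q) → ¬q q }

allVecs : (n k : ℕ) → List (Vec (Fin n) k)
allVecs n zero    = [] ∷ []
allVecs n (suc k) = concatMap (λ i → List.map (i ∷_) (allVecs n k)) (allFin n)

allFPFInvolutions : (n : ℕ) → List (Vec (Fin n) n)
allFPFInvolutions n = filter isFPFInvolution? (allVecs n n)

-- G_π has, for each vertex i, the self loop (i,i) and the edge (i, π i).
-- Since π is fixed-point free these 2n edges are distinct; we name the
-- (distinct, non-commuting) variable on the self loop at i by (i , false)
-- and the one on the edge i → π i by (i , true).

Var : ℕ → Set
Var n = Fin n × Bool

_≟ᵛ_ : ∀ {n} (x y : Var n) → Dec (x ≡ y)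
_≟ᵛ_ = Data.Product.Properties.≡-dec _≟ᶠ_ Data.Bool.Properties._≟_
  where import Data.Product.Properties
        import Data.Bool.Properties

target : ∀ {n} → Vec (Fin n) n → Var n → Fin n
target π (i , false) = i
target π (i , true)  = lookup π i

-- Non-commutative polynomials over F in variables X are represented by
-- their coefficient function on words (monomials) List X; two polynomials
-- are equal iff all coefficients agree (setoid equality of F).

module _ {c ℓ} (F : Field c ℓ) where
  open Field F

  -- Cayley permanent of G_π:  Σ_{σ ∈ S_n} x_{1,σ(1)} ⋯ x_{n,σ(n)}, where
  -- x_{i,j} is the variable of edge (i,j) of G_π and 0 if it is absent.
  -- A term is nonzero iff every (i, σ(i)) is an edge of G_π; the monomial
  -- of such a σ is the word (0,b₀)(1,b₁)⋯(n-1,b_{n-1}) whose targets are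
  -- σ, and distinct σ give distinct words. Hence the coefficient of a word
  -- w is 1 if w has this shape and i ↦ target(w_i) is a permutation of
  -- [n] (i.e. injective), and 0 otherwise.
  IsPermMonomial : ∀ {n} → Vec (Fin n) n → List (Var n) → Set
  IsPermMonomial {n} π w =
    Σ (length w ≡ n) λ eq →
      let letter : Fin n → Var n
          letter i = List.lookup w (Fin.cast (Relation.Binary.PropositionalEquality.sym eq) i)
      in (∀ i → Data.Product.proj₁ (letter i) ≡ i)
         × Injective _≡_ _≡_ (λ i → target π (letter i))
    where import Data.Product

  CayleyPermCoeff : ∀ {n} → Vec (Fin n) n → List (Var n) → Carrier → Set ℓ
  CayleyPermCoeff π w a = (IsPermMonomial π w → a ≈ 1#) × (¬ IsPermMonomial π w → a ≈ 0#)

  -- Nodes are Fin size; the DAG condition is imposed by requiring every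
  -- edge to go from a smaller to a larger node (a topological numbering,
  -- which every finite DAG admits).

  Label : Set → Set c
  Label X = Carrier ⊎ X

  record ABP (X : Set) : Set c where
    field
      size    : ℕ
      s t     : Fin size
      edges   : List (Fin size × Fin size × Label X)
      acyclic : All (λ e → toℕ (proj₁ e) < toℕ (proj₁ (proj₂ e))) edges

  -- Coefficient of the word w in the polynomial computed by the ABP:
  -- the sum over all s ⇝ t paths of the product of the labels in path
  -- order, restricted to the monomial w. 'pathsFrom k u w' sums over all
  -- paths from u to t with at most k edges; since edges increase the node
  -- number, every path has fewer than 'size' edges, so k = size covers all.
  module _ {X : Set} (_≟x_ : DecidableEquality X) (A : ABP X) where
    open ABP A

    emptyPath : Fin size → List X → Carrier
    emptyPath u []      with u ≟ᶠ t
    ... | yes _ = 1#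
    ... | no _  = 0#
    emptyPath u (_ ∷ _) = 0#

    pathsFrom : ℕ → Fin size → List X → Carrier
    pathsFrom zero    u w = emptyPath u w
    pathsFrom (suc k) u w = emptyPath u w + sumEdges edges
      where
      step : Fin size → Label X → List X → Carrier
      step v (inj₁ a) w       = a * pathsFrom k v w
      step v (inj₂ x) []      = 0#
      step v (inj₂ x) (y ∷ w') with x ≟x y
      ... | yes _ = pathsFrom k v w'
      ... | no _  = 0#

      sumEdges : List (Fin size × Fin size × Label X) → Carrier
      sumEdges [] = 0#
      sumEdges ((u' , v , lb) ∷ es) with u' ≟ᶠ u
      ... | yes _ = step v lb w + sumEdges es
      ... | no _  = sumEdges es

    coeff : List X → Carrier
    coeff w = pathsFrom size s w

  ComputesCayleyPerm : ∀ {n} → Vec (Fin n) n → ABP (Var n) → Set ℓ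
  ComputesCayleyPerm π A = ∀ w → CayleyPermCoeff π w (coeff _≟ᵛ_ A w)

module Submission where

-- Nisan's partial-derivative method. Cut the monomials of length n after position J; the matrix
-- indexed by prefixes and suffixes, whose entries are coefficients of the computed polynomial,
-- factors through the nodes of any branching program, so over a field its rank is at most the size.
-- In the Cayley permanent of G_π every pair {i, π i} with i < J ≤ π i independently uses either its
-- two self loops or its two 2-cycle edges, and a prefix and a suffix combine to a permanent monomial
-- only when they make the same choices on these crossing pairs: t crossing pairs give a 2^t × 2^t
-- identity submatrix, so 2^t ≤ size. An involution in which fewer than t pairs cross every cut is
-- determined by recording, at each position that closes a pair, which of the fewer than t open
-- pairs it closes; there are at most 2^n t^(n/2) of these, against at least (n/2)! fixed-point-free
-- involutions. With t = ⌊n/96⌋ and m^m ≤ 6^m m!, the narrow involutions form a fraction below 1/√n.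

open import Algebra.Bundles using (CommutativeRing)
open import Relation.Binary.Definitions using (DecidableEquality)

open import Defs

module Enumeration where
  open import Data.Fin using (Fin)
  open import Data.List using (List; []; _∷_; _++_; length; filter; map; concatMap; cartesianProductWith; allFin)
  open import Data.List.Properties using (length-++)
  open import Data.List.Membership.Propositional using (_∈_)
  open import Data.List.Membership.Propositional.Properties
    using (∈-∃++; ∈-cartesianProductWith⁺; ∈-allFin; ∈-filter⁺; ∈-filter⁻)
  open import Data.List.Relation.Unary.All as All using ([])
  open import Data.List.Relation.Unary.AllPairs using ([]; _∷_)
  open import Data.List.Relation.Unary.Any using (here; there)
  open import Data.List.Relation.Unary.Unique.Propositional using (Unique)
  import Data.List.Relation.Unary.Unique.Propositional.Properties as Unique
  open import Data.Nat using (zero; suc; _≤_; _+_; z≤n; s≤s)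
  import Data.Nat.Properties as ℕ
  open import Data.Product using (_,_; proj₂)
  open import Data.Vec using (Vec; []; _∷_)
  import Data.Vec.Properties as Vec
  open import Data.Empty using (⊥-elim)
  open import Relation.Nullary using (yes; no)
  open import Relation.Unary using (Pred; Decidable)
  open import Relation.Unary.Properties using (∁?)
  open import Relation.Binary.PropositionalEquality using (_≡_; _≢_; refl; sym; trans; cong; subst)

  ∈-++-remove : ∀ {A : Set} {x y : A} (ys zs : List A) → x ∈ ys ++ y ∷ zs → x ≢ y → x ∈ ys ++ zs
  ∈-++-remove []       zs (here x≡y) x≢y = ⊥-elim (x≢y x≡y)
  ∈-++-remove []       zs (there x∈) x≢y = x∈
  ∈-++-remove (y ∷ ys) zs (here x≡y) x≢y = here x≡y
  ∈-++-remove (y ∷ ys) zs (there x∈) x≢y = there (∈-++-remove ys zs x∈ x≢y)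

  length-≤-by-injection : ∀ {A B : Set} (f : A → B) {xs : List A} {ys : List B} → Unique xs →
    (∀ {x} → x ∈ xs → f x ∈ ys) → (∀ {x y} → x ∈ xs → y ∈ xs → f x ≡ f y → x ≡ y) →
    length xs ≤ length ys
  length-≤-by-injection f {[]}     _          _    _   = z≤n
  length-≤-by-injection f {x ∷ xs} (x∉ ∷ uniq) into inj with ∈-∃++ (into (here refl))
  ... | ys₁ , ys₂ , refl = subst (suc (length xs) ≤_) (sym length-split)
          (s≤s (length-≤-by-injection f uniq into′ (λ x∈ y∈ → inj (there x∈) (there y∈))))
    where
    length-split : length (ys₁ ++ f x ∷ ys₂) ≡ suc (length (ys₁ ++ ys₂))
    length-split = trans (length-++ ys₁) (trans (ℕ.+-suc (length ys₁) (length ys₂)) (cong suc (sym (length-++ ys₁))))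
    into′ : ∀ {z} → z ∈ xs → f z ∈ ys₁ ++ ys₂
    into′ z∈ = ∈-++-remove ys₁ ys₂ (into (there z∈))
      λ fz≡fx → All.lookup x∉ z∈ (sym (inj (there z∈) (here refl) fz≡fx))

  length-filter-∁ : ∀ {A : Set} {p} {P : Pred A p} (P? : Decidable P) (xs : List A) →
    length (filter P? xs) + length (filter (∁? P?) xs) ≡ length xs
  length-filter-∁ P? []       = refl
  length-filter-∁ P? (x ∷ xs) with P? x
  ... | yes _ = cong suc (length-filter-∁ P? xs)
  ... | no  _ = trans (ℕ.+-suc _ _) (cong suc (length-filter-∁ P? xs))

  concatMap-map≡cartesianProductWith : ∀ {A B C : Set} (f : A → B → C) xs ys →
    concatMap (λ x → map (f x) ys) xs ≡ cartesianProductWith f xs ys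
  concatMap-map≡cartesianProductWith f []       ys = refl
  concatMap-map≡cartesianProductWith f (x ∷ xs) ys = cong (map (f x) ys ++_) (concatMap-map≡cartesianProductWith f xs ys)

  allVecs-suc : ∀ n k → allVecs n (suc k) ≡ cartesianProductWith _∷_ (allFin n) (allVecs n k)
  allVecs-suc n k = concatMap-map≡cartesianProductWith _∷_ (allFin n) (allVecs n k)

  allVecs-unique : ∀ n k → Unique (allVecs n k)
  allVecs-unique n zero    = [] ∷ []
  allVecs-unique n (suc k) rewrite allVecs-suc n k =
    Unique.cartesianProductWith⁺ _∷_ Vec.∷-injective (Unique.allFin⁺ n) (allVecs-unique n k)

  ∈-allVecs : ∀ {n k} (v : Vec (Fin n) k) → v ∈ allVecs n k
  ∈-allVecs {n} {zero}  []      = here refl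
  ∈-allVecs {n} {suc k} (i ∷ v) rewrite allVecs-suc n k =
    ∈-cartesianProductWith⁺ _∷_ (∈-allFin i) (∈-allVecs v)

  allFPFInvolutions-unique : ∀ n → Unique (allFPFInvolutions n)
  allFPFInvolutions-unique n = Unique.filter⁺ isFPFInvolution? (allVecs-unique n n)

  ∈-allFPFInvolutions : ∀ {n} {π : Vec (Fin n) n} → IsFPFInvolution π → π ∈ allFPFInvolutions n
  ∈-allFPFInvolutions {π = π} fpf = ∈-filter⁺ isFPFInvolution? (∈-allVecs π) fpf

  ∈-allFPFInvolutions⁻ : ∀ {n} {π : Vec (Fin n) n} → π ∈ allFPFInvolutions n → IsFPFInvolution π
  ∈-allFPFInvolutions⁻ {n} π∈ = proj₂ (∈-filter⁻ isFPFInvolution? {xs = allVecs n n} π∈)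

module FinCount where
  open import Data.Fin as Fin using (Fin; zero; suc)
  import Data.Fin.Properties as Fin
  open import Data.List using (length; filter; tabulate; allFin)
  open import Data.List.Membership.Propositional.Properties using (∈-allFin; ∈-filter⁺; ∈-filter⁻)
  import Data.List.Relation.Unary.Unique.Propositional.Properties as Unique
  open import Data.Nat using (ℕ; zero; suc; _≤_; _<_; _+_; z≤n; s≤s)
  import Data.Nat.Properties as ℕ
  open import Data.Product using (Σ; _×_; _,_; proj₂)
  open import Data.Empty using (⊥; ⊥-elim)
  open import Function using (_∘_; id; Injective)
  open import Relation.Nullary using (¬_; yes; no)
  open import Relation.Unary using (Pred; Decidable; _⊆_; _≐_)
  open import Relation.Binary.PropositionalEquality using (_≡_; refl; sym; cong; subst₂)

  open Enumeration

  count : ∀ {n p} {P : Pred (Fin n) p} → Decidable P → ℕ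
  count {zero}  P? = 0
  count {suc n} P? with P? zero
  ... | yes _ = suc (count (P? ∘ suc))
  ... | no  _ = count (P? ∘ suc)

  count-mono : ∀ {n p q} {P : Pred (Fin n) p} {Q : Pred (Fin n) q} (P? : Decidable P) (Q? : Decidable Q) →
    P ⊆ Q → count P? ≤ count Q?
  count-mono {zero}  P? Q? P⊆Q = z≤n
  count-mono {suc n} P? Q? P⊆Q with P? zero | Q? zero
  ... | yes p | yes _ = s≤s (count-mono (P? ∘ suc) (Q? ∘ suc) P⊆Q)
  ... | yes p | no ¬q = ⊥-elim (¬q (P⊆Q p))
  ... | no _  | yes _ = ℕ.m≤n⇒m≤1+n (count-mono (P? ∘ suc) (Q? ∘ suc) P⊆Q)
  ... | no _  | no _  = count-mono (P? ∘ suc) (Q? ∘ suc) P⊆Q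

  count-mono-< : ∀ {n p q} {P : Pred (Fin n) p} {Q : Pred (Fin n) q} (P? : Decidable P) (Q? : Decidable Q) →
    P ⊆ Q → ∀ {k} → Q k → ¬ P k → count P? < count Q?
  count-mono-< {suc n} P? Q? P⊆Q {k} qk ¬pk with P? zero | Q? zero | k
  ... | yes p | no ¬q | _     = ⊥-elim (¬q (P⊆Q p))
  ... | yes p | yes _ | zero  = ⊥-elim (¬pk p)
  ... | yes _ | yes _ | suc k = s≤s (count-mono-< (P? ∘ suc) (Q? ∘ suc) P⊆Q {k} qk ¬pk)
  ... | no _  | yes _ | zero  = s≤s (count-mono (P? ∘ suc) (Q? ∘ suc) P⊆Q)
  ... | no _  | yes _ | suc k = ℕ.m<n⇒m<1+n (count-mono-< (P? ∘ suc) (Q? ∘ suc) P⊆Q {k} qk ¬pk)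
  ... | no _  | no ¬q | zero  = ⊥-elim (¬q qk)
  ... | no _  | no _  | suc k = count-mono-< (P? ∘ suc) (Q? ∘ suc) P⊆Q {k} qk ¬pk

  count-cong : ∀ {n p q} {P : Pred (Fin n) p} {Q : Pred (Fin n) q} (P? : Decidable P) (Q? : Decidable Q) →
    P ≐ Q → count P? ≡ count Q?
  count-cong P? Q? (P⊆Q , Q⊆P) = ℕ.≤-antisym (count-mono P? Q? P⊆Q) (count-mono Q? P? Q⊆P)

  count-disjoint : ∀ {n p q} {P : Pred (Fin n) p} {Q : Pred (Fin n) q} (P? : Decidable P) (Q? : Decidable Q) →
    (∀ {i} → P i → Q i → ⊥) → count P? + count Q? ≤ n
  count-disjoint {zero}  P? Q? disj = z≤n
  count-disjoint {suc n} P? Q? disj with P? zero | Q? zero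
  ... | yes p | yes q = ⊥-elim (disj p q)
  ... | yes _ | no _  = s≤s (count-disjoint (P? ∘ suc) (Q? ∘ suc) disj)
  ... | no _  | yes _ = subst₂ _≤_ (sym (ℕ.+-suc _ _)) refl (s≤s (count-disjoint (P? ∘ suc) (Q? ∘ suc) disj))
  ... | no _  | no _  = ℕ.m≤n⇒m≤1+n (count-disjoint (P? ∘ suc) (Q? ∘ suc) disj)

  length-filter-tabulate : ∀ {A : Set} {n p} {P : Pred A p} (P? : Decidable P) (f : Fin n → A) →
    length (filter P? (tabulate f)) ≡ count (P? ∘ f)
  length-filter-tabulate {n = zero}  P? f = refl
  length-filter-tabulate {n = suc n} P? f with P? (f zero)
  ... | yes _ = cong suc (length-filter-tabulate P? (f ∘ suc))
  ... | no  _ = length-filter-tabulate P? (f ∘ suc)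

  count-≤-by-injection : ∀ {n p q} {P : Pred (Fin n) p} {Q : Pred (Fin n) q} (P? : Decidable P) (Q? : Decidable Q) →
    (f : Fin n → Fin n) → Injective _≡_ _≡_ f → (∀ {i} → P i → Q (f i)) → count P? ≤ count Q?
  count-≤-by-injection {n} P? Q? f f-inj P⇒Qf =
    subst₂ _≤_ (length-filter-tabulate P? id) (length-filter-tabulate Q? id)
      (length-≤-by-injection f (Unique.filter⁺ P? (Unique.allFin⁺ n))
        (λ i∈ → ∈-filter⁺ Q? (∈-allFin _) (P⇒Qf (proj₂ (∈-filter⁻ P? {xs = allFin n} i∈))))
        (λ _ _ → f-inj))

  select : ∀ {n p} {P : Pred (Fin n) p} (P? : Decidable P) {t} → t ≤ count P? →
    Σ (Fin t → Fin n) λ a → Injective _≡_ _≡_ a × (∀ l → P (a l))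
  select {zero}  P? {zero} _ = (λ ()) , (λ {}) , (λ ())
  select {suc n} P? t≤ with P? zero
  select {suc n} P? {zero} _ | yes _ = (λ ()) , (λ {}) , (λ ())
  select {suc n} {P = P} P? {suc t} (s≤s t≤) | yes P0 with select (P? ∘ suc) t≤
  ... | a , a-injective , Pa = a′ , a′-injective , Pa′
    where
    a′ : Fin (suc t) → Fin (suc n)
    a′ zero    = zero
    a′ (suc l) = suc (a l)
    a′-injective : Injective _≡_ _≡_ a′
    a′-injective {zero}  {zero}   _  = refl
    a′-injective {suc l} {suc l′} eq = cong suc (a-injective (Fin.suc-injective eq))
    Pa′ : ∀ l → P (a′ l)
    Pa′ zero    = P0
    Pa′ (suc l) = Pa l
  select {suc n} P? t≤ | no _ with select (P? ∘ suc) t≤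
  ... | a , a-injective , Pa = suc ∘ a , a-injective ∘ Fin.suc-injective , Pa

module SparseWords where
  open import Data.List as List using (List; []; _∷_; _++_; length; map; cartesianProductWith; catMaybes)
  import Data.List.Properties as List
  open import Data.List.Membership.Propositional using (_∈_)
  open import Data.List.Membership.Propositional.Properties using (∈-++⁺ˡ; ∈-++⁺ʳ; ∈-map⁺; ∈-cartesianProductWith⁺)
  open import Data.List.Relation.Unary.All using (All; []; _∷_)
  open import Data.List.Relation.Unary.Any using (here)
  open import Data.Maybe using (Maybe; just; nothing)
  open import Data.Nat using (ℕ; zero; suc; _≤_; _+_; _*_; _^_; s≤s; NonZero)
  import Data.Nat.Properties as ℕ
  open import Data.Nat.Solver using (module +-*-Solver)
  open import Relation.Binary.PropositionalEquality using (_≡_; refl; sym; trans; cong₂)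

  sparseWords : ∀ {A : Set} → List A → ℕ → ℕ → List (List (Maybe A))
  sparseWords xs zero      k       = [] ∷ []
  sparseWords xs (suc len) zero    = map (nothing ∷_) (sparseWords xs len zero)
  sparseWords xs (suc len) (suc k) = map (nothing ∷_) (sparseWords xs len (suc k))
                                  ++ cartesianProductWith (λ a w → just a ∷ w) xs (sparseWords xs len k)

  length-cartesianProductWith : ∀ {A B C : Set} (f : A → B → C) xs ys →
    length (cartesianProductWith f xs ys) ≡ length xs * length ys
  length-cartesianProductWith f []       ys = refl
  length-cartesianProductWith f (x ∷ xs) ys =
    trans (List.length-++ (map (f x) ys)) (cong₂ _+_ (List.length-map (f x) ys) (length-cartesianProductWith f xs ys))

  length-sparseWords : ∀ {A : Set} (xs : List A) .{{_ : NonZero (length xs)}} len k →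
    length (sparseWords xs len k) ≤ 2 ^ len * length xs ^ k
  length-sparseWords xs zero k = ℕ.≤-trans (ℕ.m^n>0 (length xs) k) (ℕ.≤-reflexive (sym (ℕ.+-identityʳ _)))
  length-sparseWords xs (suc len) zero = begin
    length (map (nothing ∷_) (sparseWords xs len zero)) ≡⟨ List.length-map _ (sparseWords xs len zero) ⟩
    length (sparseWords xs len zero)                    ≤⟨ length-sparseWords xs len zero ⟩
    2 ^ len * 1                                         ≤⟨ ℕ.*-monoˡ-≤ 1 (ℕ.m≤n*m (2 ^ len) 2) ⟩
    2 ^ suc len * 1                                     ∎
    where open ℕ.≤-Reasoning
  length-sparseWords xs (suc len) (suc k) = begin
    length (map (nothing ∷_) (sparseWords xs len (suc k)) ++ cartesianProductWith (λ a w → just a ∷ w) xs (sparseWords xs len k))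
      ≡⟨ List.length-++ (map (nothing ∷_) (sparseWords xs len (suc k))) ⟩
    length (map (nothing ∷_) (sparseWords xs len (suc k)))
      + length (cartesianProductWith (λ a w → just a ∷ w) xs (sparseWords xs len k))
      ≡⟨ cong₂ _+_ (List.length-map _ (sparseWords xs len (suc k))) (length-cartesianProductWith _ xs (sparseWords xs len k)) ⟩
    length (sparseWords xs len (suc k)) + length xs * length (sparseWords xs len k)
      ≤⟨ ℕ.+-mono-≤ (length-sparseWords xs len (suc k)) (ℕ.*-monoʳ-≤ (length xs) (length-sparseWords xs len k)) ⟩
    2 ^ len * (length xs * length xs ^ k) + length xs * (2 ^ len * length xs ^ k)
      ≡⟨ solve 3 (λ a x b → a :* (x :* b) :+ x :* (a :* b) := (con 2 :* a) :* (x :* b))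
               refl (2 ^ len) (length xs) (length xs ^ k) ⟩
    2 ^ suc len * length xs ^ suc k ∎
    where
    open ℕ.≤-Reasoning
    open +-*-Solver using (solve; _:=_; _:+_; _:*_; con)

  ∈-sparseWords : ∀ {A : Set} {xs : List A} (w : List (Maybe A)) {k} → length (catMaybes w) ≤ k → All (_∈ xs) (catMaybes w) →
    w ∈ sparseWords xs (length w) k
  ∈-sparseWords []            _        _          = here refl
  ∈-sparseWords (nothing ∷ w) {zero}  ≤k       ∈xs        = ∈-map⁺ (nothing ∷_) (∈-sparseWords w ≤k ∈xs)
  ∈-sparseWords (nothing ∷ w) {suc k} ≤k       ∈xs        = ∈-++⁺ˡ (∈-map⁺ (nothing ∷_) (∈-sparseWords w ≤k ∈xs))
  ∈-sparseWords {xs = xs} (just a ∷ w) {suc k} (s≤s ≤k) (a∈ ∷ ∈xs) =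
    ∈-++⁺ʳ (map (nothing ∷_) (sparseWords xs (length w) (suc k)))
           (∈-cartesianProductWith⁺ (λ a w → just a ∷ w) a∈ (∈-sparseWords w ≤k ∈xs))

module FiniteSums {c ℓ} (R : CommutativeRing c ℓ) where
  open import Data.Bool using (if_then_else_)
  open import Data.Fin as Fin using (Fin; zero; suc)
  open import Data.Nat using (suc)
  open import Relation.Nullary using (does)
  import Relation.Binary.Reasoning.Setoid as SetoidReasoning

  open CommutativeRing R hiding (zero)
  open import Algebra.Properties.CommutativeMonoid.Sum +-commutativeMonoid public
    using (sum; ∑-distrib-+; sum-cong-≋; sum-replicate-zero)
  open import Algebra.Properties.Semiring.Sum semiring public using (*-distribˡ-sum)
  open SetoidReasoning setoid

  δ : ∀ {n} → Fin n → Fin n → Carrier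
  δ i j = if does (i Fin.≟ j) then 1# else 0#

  sum-zeroˡ : ∀ {n} (f : Fin n → Carrier) → sum (λ j → 0# * f j) ≈ 0#
  sum-zeroˡ {n} f = trans (sum-cong-≋ (λ j → zeroˡ (f j))) (sum-replicate-zero n)

  sum-δ : ∀ {n} (i : Fin n) (f : Fin n → Carrier) → sum (λ j → δ i j * f j) ≈ f i
  sum-δ {suc n} zero f = begin
    1# * f zero + sum (λ j → 0# * f (suc j)) ≈⟨ +-cong (*-identityˡ _) (sum-zeroˡ (λ j → f (suc j))) ⟩
    f zero + 0#                              ≈⟨ +-identityʳ _ ⟩
    f zero                                   ∎
  sum-δ {suc n} (suc i) f = begin
    0# * f zero + sum (λ j → δ i j * f (suc j)) ≈⟨ +-cong (zeroˡ _) (sum-δ i (λ j → f (suc j))) ⟩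
    0# + f (suc i)                              ≈⟨ +-identityˡ _ ⟩
    f (suc i)                                   ∎

module IdentityFactorisation {c ℓ} (F : Field c ℓ) where
  open import Data.Fin as Fin using (Fin; zero; suc; punchIn)
  import Data.Fin.Properties as Fin
  open import Data.Nat using (ℕ; zero; suc; _≤_; _<_; s≤s)
  import Data.Nat.Properties as ℕ
  open import Data.Product using (_×_; _,_; proj₁; proj₂)
  open import Effect.Monad using (RawMonad)
  open import Function using (_∘_; case_of_)
  open import Relation.Nullary using (¬_; Dec; yes; no; ¬¬-excluded-middle)
  open import Relation.Nullary.Negation using (¬¬-Monad)
  open import Relation.Binary.PropositionalEquality as ≡ using (_≡_; _≢_)
  import Algebra.Properties.Ring as RingProperties
  import Algebra.Properties.AbelianGroup as AbelianGroupProperties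
  import Algebra.Solver.CommutativeMonoid as CommutativeMonoidSolver
  import Relation.Binary.Reasoning.Setoid as SetoidReasoning

  open Field F hiding (zero)
  open FiniteSums commRing
  open RingProperties ring using (-‿distribˡ-*; -‿distribʳ-*; -‿involutive)
  open AbelianGroupProperties +-abelianGroup using (inverseʳ-unique)
  open SetoidReasoning setoid

  Matrix : ℕ → ℕ → Set c
  Matrix p q = Fin p → Fin q → Carrier

  _⊗_ : ∀ {p q r} → Matrix p q → Matrix q r → Matrix p r
  (A ⊗ B) i j = sum (λ k → A i k * B k j)

  IsIdentity : ∀ {p} → Matrix p p → Set ℓ
  IsIdentity M = ∀ i j → (i ≡ j → M i j ≈ 1#) × (i ≢ j → M i j ≈ 0#)

  IsIdentity-resp : ∀ {p} {M N : Matrix p p} → (∀ i j → M i j ≈ N i j) → IsIdentity M → IsIdentity N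
  IsIdentity-resp M≈N I i j = (trans (sym (M≈N i j)) ∘ proj₁ (I i j)) , (trans (sym (M≈N i j)) ∘ proj₂ (I i j))

  -- Being zero is not decidable in a constructive field, but for a refutation we may assume it
  -- is decidable on the finitely many entries of a column.
  private
    ¬¬-decidable : ∀ {p} (P : Fin p → Set ℓ) → ¬ ¬ (∀ i → Dec (P i))
    ¬¬-decidable P = Fin.sequence (RawMonad.rawApplicative ¬¬-Monad) (λ _ → ¬¬-excluded-middle)

  drop-zero-column : ∀ {p q} (A : Matrix p (suc q)) (B : Matrix (suc q) p) → (∀ i → A i zero ≈ 0#) →
    IsIdentity (A ⊗ B) → IsIdentity ((λ i k → A i (suc k)) ⊗ (B ∘ suc))
  drop-zero-column A B column≈0 = IsIdentity-resp λ i j → begin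
    A i zero * B zero j + sum (λ k → A i (suc k) * B (suc k) j) ≈⟨ +-cong (trans (*-cong (column≈0 i) refl) (zeroˡ _)) refl ⟩
    0# + sum (λ k → A i (suc k) * B (suc k) j)                  ≈⟨ +-identityˡ _ ⟩
    sum (λ k → A i (suc k) * B (suc k) j)                       ∎

  -- Clear column 0 by subtracting multiples of row i₀, then delete row i₀ and column 0.
  module Pivot {p q} (A : Matrix (suc p) (suc q)) (B : Matrix (suc q) (suc p)) (i₀ : Fin (suc p)) (a₀≉0 : ¬ A i₀ zero ≈ 0#) where
    a₀⁻¹ : Carrier
    a₀⁻¹ = proj₁ (inverse (A i₀ zero) a₀≉0)

    A′ : Matrix p q
    A′ r k = A (punchIn i₀ r) (suc k) - (A (punchIn i₀ r) zero * a₀⁻¹) * A i₀ (suc k)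

    B′ : Matrix q p
    B′ k c = B (suc k) (punchIn i₀ c)

    eliminate : IsIdentity (A ⊗ B) → ∀ r c → (A′ ⊗ B′) r c ≈ (A ⊗ B) (punchIn i₀ r) (punchIn i₀ c)
    eliminate I r c = begin
      sum (λ k → (A r̂ (suc k) - α * A i₀ (suc k)) * B (suc k) ĉ)
        ≈⟨ sum-cong-≋ {q} (λ k → trans (distribʳ _ _ _) (+-cong refl (sym (-‿distribˡ-* _ _)))) ⟩
      sum (λ k → A r̂ (suc k) * B (suc k) ĉ + - (α * A i₀ (suc k) * B (suc k) ĉ))
        ≈⟨ ∑-distrib-+ {q} _ _ ⟩
      rest + sum (λ k → - (α * A i₀ (suc k) * B (suc k) ĉ))
        ≈⟨ +-cong refl (sum-cong-≋ {q} (λ k → trans (-‿cong (*-assoc _ _ _)) (-‿distribˡ-* _ _))) ⟩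
      rest + sum (λ k → - α * (A i₀ (suc k) * B (suc k) ĉ))
        ≈⟨ +-cong refl (sym (*-distribˡ-sum {q} (- α) _)) ⟩
      rest + - α * pivotRest
        ≈⟨ +-cong refl (*-cong refl (inverseʳ-unique _ _ pivotRow≈0)) ⟩
      rest + - α * - (A i₀ zero * b₀)
        ≈⟨ +-cong refl (trans (sym (-‿distribˡ-* _ _)) (trans (-‿cong (sym (-‿distribʳ-* _ _))) (-‿involutive _))) ⟩
      rest + α * (A i₀ zero * b₀)
        ≈⟨ +-cong refl cancel ⟩
      rest + A r̂ zero * b₀
        ≈⟨ +-comm _ _ ⟩
      A r̂ zero * b₀ + rest ∎
      where
      r̂ ĉ : Fin (suc p)
      r̂ = punchIn i₀ r
      ĉ = punchIn i₀ c
      α b₀ rest pivotRest : Carrier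
      α = A r̂ zero * a₀⁻¹
      b₀ = B zero ĉ
      rest = sum (λ k → A r̂ (suc k) * B (suc k) ĉ)
      pivotRest = sum (λ k → A i₀ (suc k) * B (suc k) ĉ)
      pivotRow≈0 : A i₀ zero * b₀ + pivotRest ≈ 0#
      pivotRow≈0 = proj₂ (I i₀ ĉ) (Fin.punchInᵢ≢i i₀ c ∘ ≡.sym)
      cancel : α * (A i₀ zero * b₀) ≈ A r̂ zero * b₀
      cancel = begin
        A r̂ zero * a₀⁻¹ * (A i₀ zero * b₀)   ≈⟨ solve 4 (λ x y z w → (x ⊕ y) ⊕ (z ⊕ w) ⊜ (x ⊕ w) ⊕ (z ⊕ y)) refl _ _ _ _ ⟩
        A r̂ zero * b₀ * (A i₀ zero * a₀⁻¹)   ≈⟨ *-cong refl (proj₂ (inverse (A i₀ zero) a₀≉0)) ⟩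
        A r̂ zero * b₀ * 1#                   ≈⟨ *-identityʳ _ ⟩
        A r̂ zero * b₀                        ∎
        where open CommutativeMonoidSolver *-commutativeMonoid using (solve; _⊕_; _⊜_)

    identity : IsIdentity (A ⊗ B) → IsIdentity (A′ ⊗ B′)
    identity I r c =
      (λ r≡c → trans (eliminate I r c) (proj₁ (I (punchIn i₀ r) (punchIn i₀ c)) (≡.cong (punchIn i₀) r≡c))) ,
      (λ r≢c → trans (eliminate I r c) (proj₂ (I (punchIn i₀ r) (punchIn i₀ c)) (r≢c ∘ Fin.punchIn-injective i₀ r c)))

  ¬identity-factorisation : ∀ {p q} (A : Matrix p q) (B : Matrix q p) → q < p → ¬ IsIdentity (A ⊗ B)
  ¬identity-factorisation {suc p} {zero}  A B _         I = 1≉0 (sym (proj₁ (I zero zero) ≡.refl))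
  ¬identity-factorisation {suc p} {suc q} A B (s≤s q<p) I = ¬¬-decidable (λ i → A i zero ≈ 0#) λ zero? →
    case Fin.all? zero? of λ where
      (yes column≈0) → ¬identity-factorisation (λ i k → A i (suc k)) (B ∘ suc) (ℕ.m<n⇒m<1+n q<p)
                         (drop-zero-column A B column≈0 I)
      (no column≉0)  → let (i₀ , a₀≉0) = Fin.¬∀⟶∃¬ _ _ zero? column≉0
                       in ¬identity-factorisation (Pivot.A′ A B i₀ a₀≉0) (Pivot.B′ A B i₀ a₀≉0) q<p
                            (Pivot.identity A B i₀ a₀≉0 I)

  identity-factorisation-≤ : ∀ {p q} (A : Matrix p q) (B : Matrix q p) → IsIdentity (A ⊗ B) → p ≤ q
  identity-factorisation-≤ A B I = ℕ.≮⇒≥ (λ q<p → ¬identity-factorisation A B q<p I)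

module Factorisation {c ℓ} (F : Field c ℓ) {X : Set} (_≟x_ : DecidableEquality X) (A : ABP F X) where
  open import Data.Bool using (if_then_else_)
  open import Data.Empty using (⊥-elim)
  open import Data.Fin as Fin using (Fin; toℕ)
  import Data.Fin.Properties as Fin
  open import Data.List using (List; []; _∷_; _++_)
  open import Data.List.Relation.Unary.All using (All; []; _∷_)
  open import Data.Nat as ℕ using (ℕ; zero; suc; _≤_)
  import Data.Nat.Properties as ℕ
  open import Data.Product using (_×_; _,_; proj₁; proj₂)
  open import Data.Sum using (inj₁; inj₂)
  open import Relation.Nullary using (¬_; yes; no; does)
  open import Relation.Binary.PropositionalEquality as ≡ using (_≡_)
  import Relation.Binary.Reasoning.Setoid as SetoidReasoning

  open Field F hiding (zero)
  open ABP A
  open FiniteSums commRing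
  open IdentityFactorisation F using (IsIdentity; IsIdentity-resp; identity-factorisation-≤)
  open SetoidReasoning setoid

  Edge : Set c
  Edge = Fin size × Fin size × Label F X

  -- Edges increase the node number, so paths from u have fewer than size ∸ toℕ u edges and
  -- 'pathsFrom k u' has seen all of them once Budget k u holds.
  Budget : ℕ → Fin size → Set
  Budget k u = size ℕ.≤ toℕ u ℕ.+ k

  ¬Budget-zero : ∀ {u} → ¬ Budget 0 u
  ¬Budget-zero {u} b = ℕ.<⇒≱ (Fin.toℕ<n u) (ℕ.≤-trans b (ℕ.≤-reflexive (ℕ.+-identityʳ (toℕ u))))

  Budget-step : ∀ {k u v} → toℕ u ℕ.< toℕ v → Budget (suc k) u → Budget k v
  Budget-step {k} {u} u<v b = ℕ.≤-trans b (ℕ.≤-trans (ℕ.≤-reflexive (ℕ.+-suc (toℕ u) k)) (ℕ.+-monoˡ-≤ k u<v))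

  Budget-size : ∀ u → Budget size u
  Budget-size u = ℕ.m≤n+m size (toℕ u)

  outSum : (Fin size → Label F X → Carrier) → Fin size → List Edge → Carrier
  outSum f u []                    = 0#
  outSum f u ((u′ , v , lb) ∷ es) = if does (u′ Fin.≟ u) then f v lb + outSum f u es else outSum f u es

  follow : (Fin size → List X → Carrier) → Fin size → Label F X → List X → Carrier
  follow h v (inj₁ a) w       = a * h v w
  follow h v (inj₂ x) []      = 0#
  follow h v (inj₂ x) (y ∷ w) = if does (x ≟x y) then h v w else 0#

  private
    P : ℕ → Fin size → List X → Carrier
    P = pathsFrom F _≟x_ A

  -- The edge sum of 'pathsFrom' is a local function; abstracting over 'edges' lets 'unfold' name it by unification.
  mutual
    pathsFrom-suc : ∀ k u w → P (suc k) u w ≡ emptyPath F _≟x_ A u w + outSum (λ v lb → follow (P k) v lb w) u edges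
    pathsFrom-suc k u w with edges
    ... | es = ≡.cong (emptyPath F _≟x_ A u w +_) (unfold k u w es)

    unfold : ∀ k u w es → _ ≡ outSum (λ v lb → follow (P k) v lb w) u es
    unfold k u w []                            = ≡.refl
    unfold k u w ((u′ , v , lb) ∷ es) with u′ Fin.≟ u
    unfold k u w       ((u′ , v , inj₁ a) ∷ es) | yes _ = ≡.cong (a * P k v w +_) (unfold k u w es)
    unfold k u []      ((u′ , v , inj₂ x) ∷ es) | yes _ = ≡.cong (0# +_) (unfold k u [] es)
    unfold k u (y ∷ w) ((u′ , v , inj₂ x) ∷ es) | yes _ with x ≟x y
    ... | yes _ = ≡.cong (P k v w +_) (unfold k u (y ∷ w) es)
    ... | no  _ = ≡.cong (0# +_) (unfold k u (y ∷ w) es)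
    unfold k u w ((u′ , v , lb) ∷ es)           | no _ = unfold k u w es

  outSum-cong : ∀ {f g} u → (∀ {v} lb → toℕ u ℕ.< toℕ v → f v lb ≈ g v lb) →
    ∀ {es} → All (λ e → toℕ (proj₁ e) ℕ.< toℕ (proj₁ (proj₂ e))) es → outSum f u es ≈ outSum g u es
  outSum-cong u f≈g []                               = refl
  outSum-cong u f≈g {(u′ , v , lb) ∷ es} (u′<v ∷ acs) with u′ Fin.≟ u
  ... | yes ≡.refl = +-cong (f≈g lb u′<v) (outSum-cong u f≈g acs)
  ... | no  _      = outSum-cong u f≈g acs

  outSum-linear : ∀ (f : Fin size → Label F X → Fin size → Carrier) (g : Fin size → Carrier) u es →
    outSum (λ v lb → sum (λ j → f v lb j * g j)) u es ≈ sum (λ j → outSum (λ v lb → f v lb j) u es * g j)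
  outSum-linear f g u []                    = sym (sum-zeroˡ g)
  outSum-linear f g u ((u′ , v , lb) ∷ es) with u′ Fin.≟ u
  ... | no  _ = outSum-linear f g u es
  ... | yes _ = begin
    sum (λ j → f v lb j * g j) + outSum (λ v lb → sum (λ j → f v lb j * g j)) u es
      ≈⟨ +-cong refl (outSum-linear f g u es) ⟩
    sum (λ j → f v lb j * g j) + sum (λ j → outSum (λ v lb → f v lb j) u es * g j)
      ≈⟨ sym (∑-distrib-+ {size} _ _) ⟩
    sum (λ j → f v lb j * g j + outSum (λ v lb → f v lb j) u es * g j)
      ≈⟨ sum-cong-≋ {size} (λ j → sym (distribʳ (g j) _ _)) ⟩
    sum (λ j → (f v lb j + outSum (λ v lb → f v lb j) u es) * g j) ∎

  follow-cong : ∀ {h h′} v lb w → (∀ w′ → h v w′ ≈ h′ v w′) → follow h v lb w ≈ follow h′ v lb w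
  follow-cong v (inj₁ a) w       h≈h′ = *-cong refl (h≈h′ w)
  follow-cong v (inj₂ x) []      h≈h′ = refl
  follow-cong v (inj₂ x) (y ∷ w) h≈h′ with x ≟x y
  ... | yes _ = h≈h′ w
  ... | no  _ = refl

  pathsFrom-stable : ∀ k k′ u w → Budget k u → Budget k′ u → P k u w ≈ P k′ u w
  pathsFrom-stable zero     k′       u w b b′ = ⊥-elim (¬Budget-zero b)
  pathsFrom-stable (suc k)  zero     u w b b′ = ⊥-elim (¬Budget-zero b′)
  pathsFrom-stable (suc k)  (suc k′) u w b b′ = begin
    P (suc k) u w                                                         ≡⟨ pathsFrom-suc k u w ⟩
    emptyPath F _≟x_ A u w + outSum (λ v lb → follow (P k) v lb w) u edges  ≈⟨ +-cong refl (outSum-cong u step acyclic) ⟩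
    emptyPath F _≟x_ A u w + outSum (λ v lb → follow (P k′) v lb w) u edges ≡⟨ ≡.sym (pathsFrom-suc k′ u w) ⟩
    P (suc k′) u w                                                        ∎
    where
    step : ∀ {v} lb → toℕ u ℕ.< toℕ v → follow (P k) v lb w ≈ follow (P k′) v lb w
    step {v} lb u<v = follow-cong v lb w λ w′ → pathsFrom-stable k k′ v w′ (Budget-step u<v b) (Budget-step u<v b′)

  suffixWeight : Fin size → List X → Carrier
  suffixWeight = P size

  -- Paths from u to v reading exactly p and ending with the edge that reads the last letter of p, so that
  -- a path reading p ++ w splits at a unique node.
  prefixWeight : ℕ → Fin size → List X → Fin size → Carrier
  prefixWeight k       u []      v = δ u v
  prefixWeight zero    u (_ ∷ _) v = 0#
  prefixWeight (suc k) u (y ∷ p) v =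
    outSum (λ v′ lb → follow (λ v″ p′ → prefixWeight k v″ p′ v) v′ lb (y ∷ p)) u edges

  follow-factor : ∀ {h : Fin size → List X → Carrier} {g : Fin size → List X → Fin size → Carrier} v′ w →
    (∀ p → h v′ (p ++ w) ≈ sum (λ v → g v′ p v * suffixWeight v w)) →
    ∀ lb y p → follow h v′ lb (y ∷ p ++ w)
             ≈ sum (λ v → follow (λ v″ p′ → g v″ p′ v) v′ lb (y ∷ p) * suffixWeight v w)
  follow-factor {h} {g} v′ w h≈ (inj₁ a) y p = begin
    a * h v′ (y ∷ p ++ w)                                ≈⟨ *-cong refl (h≈ (y ∷ p)) ⟩
    a * sum (λ v → g v′ (y ∷ p) v * suffixWeight v w)    ≈⟨ *-distribˡ-sum {size} a _ ⟩
    sum (λ v → a * (g v′ (y ∷ p) v * suffixWeight v w))  ≈⟨ sum-cong-≋ {size} (λ v → sym (*-assoc a _ _)) ⟩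
    sum (λ v → a * g v′ (y ∷ p) v * suffixWeight v w)    ∎
  follow-factor v′ w h≈ (inj₂ x) y p with x ≟x y
  ... | yes _ = h≈ p
  ... | no  _ = sym (sum-zeroˡ (λ v → suffixWeight v w))

  factorise : ∀ k u → Budget k u → ∀ p w → P k u (p ++ w) ≈ sum (λ v → prefixWeight k u p v * suffixWeight v w)
  factorise k       u b []      w = begin
    P k u w                                ≈⟨ pathsFrom-stable k size u w b (Budget-size u) ⟩
    suffixWeight u w                       ≈⟨ sym (sum-δ u (λ v → suffixWeight v w)) ⟩
    sum (λ v → δ u v * suffixWeight v w)   ∎
  factorise zero    u b (y ∷ p) w = ⊥-elim (¬Budget-zero b)
  factorise (suc k) u b (y ∷ p) w = begin
    P (suc k) u (y ∷ p ++ w)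
      ≡⟨ pathsFrom-suc k u (y ∷ p ++ w) ⟩
    0# + outSum (λ v′ lb → follow (P k) v′ lb (y ∷ p ++ w)) u edges
      ≈⟨ +-identityˡ _ ⟩
    outSum (λ v′ lb → follow (P k) v′ lb (y ∷ p ++ w)) u edges
      ≈⟨ outSum-cong u step acyclic ⟩
    outSum (λ v′ lb → sum (λ v → follow (λ v″ p′ → prefixWeight k v″ p′ v) v′ lb (y ∷ p) * suffixWeight v w)) u edges
      ≈⟨ outSum-linear (λ v′ lb v → follow (λ v″ p′ → prefixWeight k v″ p′ v) v′ lb (y ∷ p))
                       (λ v → suffixWeight v w) u edges ⟩
    sum (λ v → prefixWeight (suc k) u (y ∷ p) v * suffixWeight v w) ∎
    where
    step : ∀ {v′} lb → toℕ u ℕ.< toℕ v′ →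
      follow (P k) v′ lb (y ∷ p ++ w)
        ≈ sum (λ v → follow (λ v″ p′ → prefixWeight k v″ p′ v) v′ lb (y ∷ p) * suffixWeight v w)
    step {v′} lb u<v′ = follow-factor v′ w (λ p′ → factorise k v′ (Budget-step u<v′ b) p′ w) lb y p

  coeff-factorise : ∀ p w → coeff F _≟x_ A (p ++ w) ≈ sum (λ v → prefixWeight size s p v * suffixWeight v w)
  coeff-factorise = factorise size s (Budget-size s)

  -- By coeff-factorise the coefficient matrix factors through the nodes, so its rank is at most size.
  fooling-set-≤-size : ∀ {N} (u v : Fin N → List X) → IsIdentity (λ x y → coeff F _≟x_ A (u x ++ v y)) → N ≤ size
  fooling-set-≤-size u v I = identity-factorisation-≤
    (λ x → prefixWeight size s (u x)) (λ node y → suffixWeight node (v y))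
    (IsIdentity-resp (λ x y → coeff-factorise (u x) (v y)) I)

module CayleyPermanent where
  open import Data.Bool using (Bool; true; false)
  open import Data.Empty using (⊥-elim)
  open import Data.Fin as Fin using (Fin; zero; suc; toℕ; combine; funToFin; finToFun)
  import Data.Fin.Properties as Fin
  open import Data.List using (List; _∷_; _++_; take; drop; tabulate)
  import Data.List.Properties as List
  open import Data.Nat using (ℕ; zero; suc; _≤_; _<_; _<?_; _^_; z≤n; s≤s)
  import Data.Nat.Properties as ℕ
  import Data.Bool.Properties as Bool
  open import Data.Product using (Σ; _,_; proj₁; proj₂)
  open import Data.Vec using (Vec; lookup)
  open import Function using (_∘_; Injective)
  open import Relation.Nullary using (¬_; yes; no)
  open import Relation.Binary.PropositionalEquality using (_≡_; _≢_; refl; sym; trans; cong; cong₂; subst)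

  take-tabulate-cong : ∀ {A : Set} {m} J (f g : Fin m → A) → (∀ i → toℕ i < J → f i ≡ g i) →
    take J (tabulate f) ≡ take J (tabulate g)
  take-tabulate-cong zero    f g f≡g = refl
  take-tabulate-cong {m = zero}  (suc J) f g f≡g = refl
  take-tabulate-cong {m = suc m} (suc J) f g f≡g =
    cong₂ _∷_ (f≡g zero (s≤s z≤n)) (take-tabulate-cong J (f ∘ suc) (g ∘ suc) (λ i i<J → f≡g (suc i) (s≤s i<J)))

  drop-tabulate-cong : ∀ {A : Set} {m} J (f g : Fin m → A) → (∀ i → J ≤ toℕ i → f i ≡ g i) →
    drop J (tabulate f) ≡ drop J (tabulate g)
  drop-tabulate-cong {m = zero}  J       f g f≡g = refl
  drop-tabulate-cong {m = suc m} zero    f g f≡g =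
    cong₂ _∷_ (f≡g zero z≤n) (drop-tabulate-cong 0 (f ∘ suc) (g ∘ suc) (λ i _ → f≡g (suc i) z≤n))
  drop-tabulate-cong {m = suc m} (suc J) f g f≡g =
    drop-tabulate-cong J (f ∘ suc) (g ∘ suc) (λ i J≤i → f≡g (suc i) (s≤s J≤i))

  module CayleyMonomials {n} (π : Vec (Fin n) n) (fpf : IsFPFInvolution π) where
    private
      π-involutive : ∀ i → lookup π (lookup π i) ≡ i
      π-involutive = proj₁ fpf
      π-fixfree : ∀ i → lookup π i ≢ i
      π-fixfree = proj₂ fpf

    word : (Fin n → Bool) → List (Var n)
    word γ = tabulate (λ i → i , γ i)

    Invariant : (Fin n → Bool) → Set
    Invariant γ = ∀ i → γ (lookup π i) ≡ γ i

    target-injective : ∀ {γ} → Invariant γ → Injective _≡_ _≡_ (λ i → target π (i , γ i))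
    target-injective {γ} inv {i} {j} eq with γ i in γi | γ j in γj
    ... | false | false = eq
    ... | true  | true  = trans (sym (π-involutive i)) (trans (cong (lookup π) eq) (π-involutive j))
    ... | true  | false with () ← trans (sym γi) (trans (sym (inv i)) (trans (cong γ eq) γj))
    ... | false | true  with () ← trans (sym γj) (trans (sym (inv j)) (trans (cong γ (sym eq)) γi))

    invariant-of-target-injective : ∀ {γ} → Injective _≡_ _≡_ (λ i → target π (i , γ i)) → Invariant γ
    invariant-of-target-injective {γ} inj i with γ i in γi | γ (lookup π i) in γπi
    ... | true  | true  = refl
    ... | false | false = refl
    ... | true  | false = ⊥-elim (π-fixfree i (sym (inj (trans (cong (target π ∘ (i ,_)) γi)
                                                     (cong (target π ∘ (lookup π i ,_)) (sym γπi))))))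
    ... | false | true  = ⊥-elim (π-fixfree i (sym (inj (trans (cong (target π ∘ (i ,_)) γi)
                                                     (trans (sym (π-involutive i)) (cong (target π ∘ (lookup π i ,_)) (sym γπi)))))))

    module _ {c ℓ} (F : Field c ℓ) where
      isPermMonomial-word : ∀ {γ} → Invariant γ → IsPermMonomial F π (word γ)
      isPermMonomial-word {γ} inv =
        List.length-tabulate _ , (λ i → cong proj₁ (List.lookup-tabulate _ i)) , λ {i} {j} eq →
          target-injective inv (trans (cong (target π) (sym (List.lookup-tabulate _ i)))
                                      (trans eq (cong (target π) (List.lookup-tabulate _ j))))

      invariant-of-isPermMonomial : ∀ {γ} → IsPermMonomial F π (word γ) → Invariant γ
      invariant-of-isPermMonomial {γ} (_ , _ , inj) = invariant-of-target-injective λ {i} {j} eq →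
        inj (trans (cong (target π) (List.lookup-tabulate _ i)) (trans eq (cong (target π) (sym (List.lookup-tabulate _ j)))))

  bit : Fin 2 → Bool
  bit zero    = false
  bit (suc _) = true

  bit-injective : Injective _≡_ _≡_ bit
  bit-injective {zero}     {zero}     _ = refl
  bit-injective {suc zero} {suc zero} _ = refl

  funToFin-cong : ∀ {m k} {f g : Fin m → Fin k} → (∀ i → f i ≡ g i) → funToFin f ≡ funToFin g
  funToFin-cong {zero}  f≗g = refl
  funToFin-cong {suc m} f≗g = cong₂ combine (f≗g zero) (funToFin-cong (f≗g ∘ suc))

  finToFun-injective : ∀ {m k} {x y : Fin (m ^ k)} → (∀ i → finToFun {m} {k} x i ≡ finToFun y i) → x ≡ y
  finToFun-injective {m} {k} {x} {y} x≗y =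
    trans (sym (Fin.funToFin-finToFin {k} {m} x)) (trans (funToFin-cong {k} {m} x≗y) (Fin.funToFin-finToFin {k} {m} y))

  module CayleyFoolingSet {c ℓ} (F : Field c ℓ) {n} (π : Vec (Fin n) n) (fpf : IsFPFInvolution π)
                          (J : ℕ) {t} (a : Fin t → Fin n) (a-injective : Injective _≡_ _≡_ a)
                          (a<J : ∀ l → toℕ (a l) < J) (J≤πa : ∀ l → J ≤ toℕ (lookup π (a l))) where
    open Field F using (_≈_; reflexive) renaming (trans to ≈-trans)
    open CayleyMonomials π fpf
    open IdentityFactorisation F using (IsIdentity)

    private
      π-involutive : ∀ i → lookup π (lookup π i) ≡ i
      π-involutive = proj₁ fpf

    colour : (Fin t → Bool) → Fin n → Bool
    colour b i with Fin.any? (λ l → a l Fin.≟ i)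
    ... | yes (l , _) = b l
    ... | no  _       = false

    colour-a : ∀ b l → colour b (a l) ≡ b l
    colour-a b l with Fin.any? (λ l′ → a l′ Fin.≟ a l)
    ... | yes (l′ , al′≡al) = cong b (a-injective al′≡al)
    ... | no  ∄l′           = ⊥-elim (∄l′ (l , refl))

    colour-outside : ∀ b {i} → (∀ l → a l ≢ i) → colour b i ≡ false
    colour-outside b {i} i∉a with Fin.any? (λ l → a l Fin.≟ i)
    ... | yes (l , al≡i) = ⊥-elim (i∉a l al≡i)
    ... | no  _          = refl

    -- A crossing pair is coloured by b in the prefix and by b′ in the suffix, so mixed b b′ is
    -- π-invariant exactly when b and b′ agree.
    mixed : (Fin t → Bool) → (Fin t → Bool) → Fin n → Bool
    mixed b b′ i with toℕ i <? J
    ... | yes _ = colour b i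
    ... | no  _ = colour b′ (lookup π i)

    prefix : (Fin t → Bool) → List (Var n)
    prefix b = take J (word (colour b))

    suffix : (Fin t → Bool) → List (Var n)
    suffix b′ = drop J (word (colour b′ ∘ lookup π))

    prefix++suffix : ∀ b b′ → prefix b ++ suffix b′ ≡ word (mixed b b′)
    prefix++suffix b b′ = trans (cong₂ _++_ (take-tabulate-cong J _ _ before) (drop-tabulate-cong J _ _ after))
                                (List.take++drop≡id J (word (mixed b b′)))
      where
      before : ∀ i → toℕ i < J → (i , colour b i) ≡ (i , mixed b b′ i)
      before i i<J with toℕ i <? J
      ... | yes _   = refl
      ... | no  i≮J = ⊥-elim (i≮J i<J)
      after : ∀ i → J ≤ toℕ i → (i , colour b′ (lookup π i)) ≡ (i , mixed b b′ i)
      after i J≤i with toℕ i <? J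
      ... | yes i<J = ⊥-elim (ℕ.<⇒≱ i<J J≤i)
      ... | no  _   = refl

    outside-if-partner-before : ∀ {i} → toℕ (lookup π i) < J → ∀ l → a l ≢ i
    outside-if-partner-before πi<J l refl = ℕ.<⇒≱ πi<J (J≤πa l)

    outside-if-after : ∀ {i} → J ≤ toℕ i → ∀ l → a l ≢ i
    outside-if-after J≤i l refl = ℕ.<⇒≱ (a<J l) J≤i

    mixed-invariant : ∀ b → Invariant (mixed b b)
    mixed-invariant b i with toℕ i <? J | toℕ (lookup π i) <? J
    ... | yes i<J | yes πi<J =
      trans (colour-outside b (outside-if-partner-before (subst (λ j → toℕ j < J) (sym (π-involutive i)) i<J)))
                                     (sym (colour-outside b (outside-if-partner-before πi<J)))
    ... | yes _   | no  _    = cong (colour b) (π-involutive i)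
    ... | no  _   | yes _    = refl
    ... | no  i≮J | no  πi≮J = trans (cong (colour b) (π-involutive i))
                                     (trans (colour-outside b (outside-if-after (ℕ.≮⇒≥ i≮J)))
                                            (sym (colour-outside b (outside-if-after (ℕ.≮⇒≥ πi≮J)))))

    mixed-not-invariant : ∀ b b′ l → b l ≢ b′ l → ¬ Invariant (mixed b b′)
    mixed-not-invariant b b′ l bl≢b′l inv = bl≢b′l (trans (sym at-a) (trans (sym (inv (a l))) at-πa))
      where
      at-a : mixed b b′ (a l) ≡ b l
      at-a with toℕ (a l) <? J
      ... | yes _   = colour-a b l
      ... | no  a≮J = ⊥-elim (a≮J (a<J l))
      at-πa : mixed b b′ (lookup π (a l)) ≡ b′ l
      at-πa with toℕ (lookup π (a l)) <? J
      ... | yes πa<J = ⊥-elim (ℕ.<⇒≱ πa<J (J≤πa l))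
      ... | no  _    = trans (cong (colour b′) (π-involutive (a l))) (colour-a b′ l)

    rowPattern : Fin (2 ^ t) → Fin t → Bool
    rowPattern x = bit ∘ finToFun x

    rowPattern-distinct : ∀ {x y} → x ≢ y → Σ (Fin t) λ l → rowPattern x l ≢ rowPattern y l
    rowPattern-distinct {x} {y} x≢y =
      Fin.¬∀⟶∃¬ t _ (λ l → rowPattern x l Bool.≟ rowPattern y l)
        (λ x≗y → x≢y (finToFun-injective {2} {t} (bit-injective ∘ x≗y)))

    2^t≤size : (A : ABP F (Var n)) → ComputesCayleyPerm F π A → 2 ^ t ≤ ABP.size A
    2^t≤size A computes = Factorisation.fooling-set-≤-size F _≟ᵛ_ A (prefix ∘ rowPattern) (suffix ∘ rowPattern) identity
      where
      coeff-mixed : ∀ x y → coeff F _≟ᵛ_ A (prefix (rowPattern x) ++ suffix (rowPattern y))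
                          ≈ coeff F _≟ᵛ_ A (word (mixed (rowPattern x) (rowPattern y)))
      coeff-mixed x y = reflexive (cong (coeff F _≟ᵛ_ A) (prefix++suffix (rowPattern x) (rowPattern y)))
      identity : IsIdentity (λ x y → coeff F _≟ᵛ_ A (prefix (rowPattern x) ++ suffix (rowPattern y)))
      identity x y =
        (λ { refl → ≈-trans (coeff-mixed x x) (proj₁ (computes _) (isPermMonomial-word F (mixed-invariant (rowPattern x)))) }) ,
        (λ x≢y → let (l , differ) = rowPattern-distinct x≢y in
          ≈-trans (coeff-mixed x y) (proj₂ (computes _) (mixed-not-invariant _ _ l differ ∘ invariant-of-isPermMonomial F)))

module CrossingCodes where
  open import Level using (0ℓ)
  open import Data.Empty using (⊥-elim)
  open import Data.Fin as Fin using (Fin; zero; suc; toℕ)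
  import Data.Fin.Properties as Fin
  import Data.Fin.Induction as Fin
  open import Data.List using (List; length; tabulate; catMaybes; upTo; filter)
  import Data.List.Properties as List
  open import Data.List.Membership.Propositional using (_∈_)
  open import Data.List.Membership.Propositional.Properties using (∈-upTo⁺; ∈-filter⁻)
  import Data.List.Relation.Unary.Unique.Propositional.Properties as Unique
  import Data.List.Relation.Unary.All.Properties as All
  open import Data.Maybe using (Maybe; just; nothing)
  import Data.Maybe.Relation.Unary.All as Maybe
  open import Data.Nat as ℕ using (ℕ; zero; suc; _≤_; _<_; _+_; _*_; _^_; _<?_; _≤?_; z≤n; s≤s; NonZero)
  import Data.Nat.Properties as ℕ
  open import Data.Product using (_×_; _,_; proj₁; proj₂; map₁)
  open import Data.Sum using (_⊎_; inj₁; inj₂)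
  open import Data.Vec as Vec using (Vec; lookup)
  import Data.Vec.Properties as Vec
  open import Function using (_∘_; Injective; it)
  open import Induction.WellFounded using (module All)
  open import Relation.Binary.Definitions using (tri<; tri≈; tri>)
  open import Relation.Nullary using (¬_; yes; no; _×-dec_)
  open import Relation.Unary using (Pred; Decidable)
  open import Relation.Binary.PropositionalEquality using (_≡_; _≢_; refl; sym; trans; cong; subst)

  open FinCount
  open Enumeration
  open SparseWords

  tabulate-injective : ∀ {A : Set} {m} {f g : Fin m → A} → tabulate f ≡ tabulate g → ∀ i → f i ≡ g i
  tabulate-injective {m = suc m} eq zero    = proj₁ (List.∷-injective eq)
  tabulate-injective {m = suc m} eq (suc i) = tabulate-injective (proj₂ (List.∷-injective eq)) i

  length-catMaybes-tabulate : ∀ {A : Set} {m p} {P : Pred (Fin m) p} (P? : Decidable P) (g : Fin m → Maybe A) →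
    (∀ j → ¬ P j → g j ≡ nothing) → length (catMaybes (tabulate g)) ≤ count P?
  length-catMaybes-tabulate {m = zero}  P? g off = z≤n
  length-catMaybes-tabulate {m = suc m} P? g off with P? zero | g zero in g0
  ... | yes _ | just _  = s≤s (length-catMaybes-tabulate (P? ∘ suc) (g ∘ suc) (off ∘ suc))
  ... | yes _ | nothing = ℕ.m≤n⇒m≤1+n (length-catMaybes-tabulate (P? ∘ suc) (g ∘ suc) (off ∘ suc))
  ... | no ¬p | just _  with () ← trans (sym g0) (off zero ¬p)
  ... | no _  | nothing = length-catMaybes-tabulate (P? ∘ suc) (g ∘ suc) (off ∘ suc)

  private
    variable
      n : ℕ

  -- i opens a pair {i, π i} that is still open at cut J (between positions J - 1 and J).
  Crosses : Vec (Fin n) n → ℕ → Pred (Fin n) 0ℓ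
  Crosses π J i = toℕ i < J × J ≤ toℕ (lookup π i)

  crosses? : ∀ (π : Vec (Fin n) n) J → Decidable (Crosses π J)
  crosses? π J i = toℕ i <? J ×-dec J ≤? toℕ (lookup π i)

  width : Vec (Fin n) n → ℕ → ℕ
  width π J = count (crosses? π J)

  rank : Vec (Fin n) n → ℕ → Fin n → ℕ
  rank π J x = count (λ i → crosses? π J i ×-dec i Fin.<? x)

  rank<width : ∀ {π : Vec (Fin n) n} {J x} → Crosses π J x → rank π J x < width π J
  rank<width {π = π} {J = J} {x = x} x-crosses =
    count-mono-< _ (crosses? π J) proj₁ {x} x-crosses (Fin.<-irrefl refl ∘ proj₂)

  rank-mono-< : ∀ {π : Vec (Fin n) n} {J x y} → Crosses π J x → x Fin.< y → rank π J x < rank π J y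
  rank-mono-< {π = π} {J = J} {x = x} {y = y} x-crosses x<y =
    count-mono-< _ _ (λ (i-crosses , i<x) → i-crosses , Fin.<-trans i<x x<y) {x} (x-crosses , x<y) (Fin.<-irrefl refl ∘ proj₂)

  rank-injective : ∀ {π : Vec (Fin n) n} {J x y} → Crosses π J x → Crosses π J y → rank π J x ≡ rank π J y → x ≡ y
  rank-injective {π = π} {J = J} {x = x} {y = y} x-crosses y-crosses eq with Fin.<-cmp x y
  ... | tri< x<y _ _ = ⊥-elim (ℕ.<⇒≢ (rank-mono-< {π = π} {J = J} x-crosses x<y) eq)
  ... | tri≈ _ x≡y _ = x≡y
  ... | tri> _ _ y<x = ⊥-elim (ℕ.<⇒≢ (rank-mono-< {π = π} {J = J} y-crosses y<x) (sym eq))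

  Closes : Vec (Fin n) n → Pred (Fin n) 0ℓ
  Closes π j = lookup π j Fin.< j

  closes? : ∀ (π : Vec (Fin n) n) → Decidable (Closes π)
  closes? π j = lookup π j Fin.<? j

  -- A closing position j records which of the pairs open at cut j it closes.
  codeEntry : Vec (Fin n) n → Fin n → Maybe ℕ
  codeEntry π j with lookup π j Fin.<? j
  ... | yes _ = just (rank π (toℕ j) (lookup π j))
  ... | no  _ = nothing

  code : Vec (Fin n) n → List (Maybe ℕ)
  code π = tabulate (codeEntry π)

  Narrow : ℕ → Vec (Fin n) n → Set
  Narrow {n} t π = ∀ (J : Fin n) → width π (toℕ J) < t

  narrow? : ∀ t → Decidable (Narrow {n} t)
  narrow? t π = Fin.all? (λ J → width π (toℕ J) <? t)

  codeEntry-closes : ∀ (π : Vec (Fin n) n) {j} → Closes π j → codeEntry π j ≡ just (rank π (toℕ j) (lookup π j))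
  codeEntry-closes π {j} closes with lookup π j Fin.<? j
  ... | yes _   = refl
  ... | no  ¬closes = ⊥-elim (¬closes closes)

  codeEntry-¬closes : ∀ (π : Vec (Fin n) n) {j} → ¬ Closes π j → codeEntry π j ≡ nothing
  codeEntry-¬closes π {j} ¬closes with lookup π j Fin.<? j
  ... | yes closes = ⊥-elim (¬closes closes)
  ... | no  _      = refl

  closes-of-codeEntry : ∀ (π : Vec (Fin n) n) {j r} → codeEntry π j ≡ just r → Closes π j
  closes-of-codeEntry π {j} eq with lookup π j Fin.<? j
  ... | yes closes = closes
  ... | no  _      with () ← eq

  module FPF {n} (π : Vec (Fin n) n) (fpf : IsFPFInvolution π) where
    involutive : ∀ i → lookup π (lookup π i) ≡ i
    involutive = proj₁ fpf

    fixfree : ∀ i → lookup π i ≢ i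
    fixfree = proj₂ fpf

    partner-crosses : ∀ {j} → Closes π j → Crosses π (toℕ j) (lookup π j)
    partner-crosses {j} closes = closes , ℕ.≤-reflexive (cong toℕ (sym (involutive j)))

    opens-of-¬closes : ∀ {i} → ¬ Closes π i → i Fin.< lookup π i
    opens-of-¬closes {i} ¬closes with Fin.<-cmp i (lookup π i)
    ... | tri< i<πi _ _ = i<πi
    ... | tri≈ _ i≡πi _ = ⊥-elim (fixfree i (sym i≡πi))
    ... | tri> _ _ πi<i = ⊥-elim (¬closes πi<i)

    partner-closes : ∀ {i} → ¬ Closes π i → Closes π (lookup π i)
    partner-closes {i} ¬closes = subst (Fin._< lookup π i) (sym (involutive i)) (opens-of-¬closes ¬closes)

    closers-half : count (closes? π) + count (closes? π) ≤ n
    closers-half = ℕ.≤-trans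
      (ℕ.+-monoʳ-≤ (count (closes? π))
        (count-≤-by-injection (closes? π) opens? (lookup π) π-injective
          (λ {j} closes → subst (lookup π j Fin.<_) (sym (involutive j)) closes)))
      (count-disjoint (closes? π) opens? Fin.<-asym)
      where
      opens? : Decidable (λ j → j Fin.< lookup π j)
      opens? j = j Fin.<? lookup π j
      π-injective : Injective _≡_ _≡_ (lookup π)
      π-injective {i} {j} eq = trans (sym (involutive i)) (trans (cong (lookup π) eq) (involutive j))

    codeEntry-bounded : ∀ {t} → Narrow t π → ∀ j → Maybe.All (_∈ upTo t) (codeEntry π j)
    codeEntry-bounded narrow j with lookup π j Fin.<? j
    ... | yes closes = Maybe.just (∈-upTo⁺ (ℕ.<-≤-trans (rank<width {π = π} (partner-crosses closes)) (ℕ.<⇒≤ (narrow j))))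
    ... | no  _      = Maybe.nothing

  -- Scanning left to right, the entries of the code determine the partner of every closing position.
  module SameCode {n} (π π′ : Vec (Fin n) n) (fpf : IsFPFInvolution π) (fpf′ : IsFPFInvolution π′)
                  (same : code π ≡ code π′) where
    private
      module π  = FPF π fpf
      module π′ = FPF π′ fpf′

      entries : ∀ j → codeEntry π j ≡ codeEntry π′ j
      entries = tabulate-injective same

      just-injective : ∀ {a b : ℕ} → just a ≡ just b → a ≡ b
      just-injective refl = refl

    closes⇒closes′ : ∀ {j} → Closes π j → Closes π′ j
    closes⇒closes′ {j} closes = closes-of-codeEntry π′ (trans (sym (entries j)) (codeEntry-closes π closes))

    closes′⇒closes : ∀ {j} → Closes π′ j → Closes π j
    closes′⇒closes {j} closes′ = closes-of-codeEntry π (trans (entries j) (codeEntry-closes π′ closes′))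

    module Step (j : Fin n) (IH : ∀ {k} → k Fin.< j → Closes π k → lookup π k ≡ lookup π′ k) where
      J : ℕ
      J = toℕ j

      partners-before : ∀ i → toℕ i < J →
        lookup π i ≡ lookup π′ i ⊎ (J ≤ toℕ (lookup π i) × J ≤ toℕ (lookup π′ i))
      partners-before i i<J with lookup π i Fin.<? i
      ... | yes closes = inj₁ (IH i<J closes)
      ... | no ¬closes with toℕ (lookup π i) <? J | toℕ (lookup π′ i) <? J
      ...   | yes πi<J | _ = inj₁ (sym (trans (cong (lookup π′) (sym π′πi≡i)) (π′.involutive (lookup π i))))
        where
        π′πi≡i : lookup π′ (lookup π i) ≡ i
        π′πi≡i = trans (sym (IH πi<J (π.partner-closes ¬closes))) (π.involutive i)
      ...   | no _ | yes π′i<J = inj₁ (trans (cong (lookup π) (sym ππ′i≡i)) (π.involutive (lookup π′ i)))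
        where
        ππ′i≡i : lookup π (lookup π′ i) ≡ i
        ππ′i≡i = trans (IH π′i<J (closes′⇒closes (π′.partner-closes (¬closes ∘ closes′⇒closes)))) (π′.involutive i)
      ...   | no πi≮J | no π′i≮J = inj₂ (ℕ.≮⇒≥ πi≮J , ℕ.≮⇒≥ π′i≮J)

      crosses⇒crosses′ : ∀ {i} → Crosses π J i → Crosses π′ J i
      crosses⇒crosses′ {i} (i<J , J≤πi) with partners-before i i<J
      ... | inj₁ πi≡π′i        = i<J , subst (λ k → J ≤ toℕ k) πi≡π′i J≤πi
      ... | inj₂ (_ , J≤π′i)   = i<J , J≤π′i

      crosses′⇒crosses : ∀ {i} → Crosses π′ J i → Crosses π J i
      crosses′⇒crosses {i} (i<J , J≤π′i) with partners-before i i<J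
      ... | inj₁ πi≡π′i        = i<J , subst (λ k → J ≤ toℕ k) (sym πi≡π′i) J≤π′i
      ... | inj₂ (J≤πi , _)    = i<J , J≤πi

      partner-agrees : Closes π j → lookup π j ≡ lookup π′ j
      partner-agrees closes =
        rank-injective {π = π} {J = J} (π.partner-crosses closes) (crosses′⇒crosses (π′.partner-crosses closes′)) same-rank
        where
        closes′ : Closes π′ j
        closes′ = closes⇒closes′ closes
        same-rank : rank π J (lookup π j) ≡ rank π J (lookup π′ j)
        same-rank = trans (just-injective (trans (sym (codeEntry-closes π closes)) (trans (entries j) (codeEntry-closes π′ closes′))))
                          (count-cong (λ i → crosses? π′ J i ×-dec i Fin.<? lookup π′ j) (λ i → crosses? π J i ×-dec i Fin.<? lookup π′ j)
                            ((λ (c , i<) → crosses′⇒crosses c , i<) , (λ (c , i<) → crosses⇒crosses′ c , i<)))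

    closing-partners-agree : ∀ j → Closes π j → lookup π j ≡ lookup π′ j
    closing-partners-agree = All.wfRec Fin.<-wellFounded 0ℓ (λ j → Closes π j → lookup π j ≡ lookup π′ j)
      (λ j IH → Step.partner-agrees j IH)

    partners-agree : ∀ i → lookup π i ≡ lookup π′ i
    partners-agree i with lookup π i Fin.<? i
    ... | yes closes = closing-partners-agree i closes
    ... | no ¬closes = trans (sym (π′.involutive (lookup π i))) (cong (lookup π′) π′πi≡i)
      where
      π′πi≡i : lookup π′ (lookup π i) ≡ i
      π′πi≡i = trans (sym (closing-partners-agree (lookup π i) (π.partner-closes ¬closes))) (π.involutive i)

  code-injective : ∀ {π π′ : Vec (Fin n) n} → IsFPFInvolution π → IsFPFInvolution π′ → code π ≡ code π′ → π ≡ π′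
  code-injective {π = π} {π′} fpf fpf′ same =
    trans (sym (Vec.tabulate∘lookup π))
          (trans (Vec.tabulate-cong (SameCode.partners-agree π π′ fpf fpf′ same)) (Vec.tabulate∘lookup π′))

  m+m≤n+n⇒m≤n : ∀ {m n} → m + m ≤ n + n → m ≤ n
  m+m≤n+n⇒m≤n m+m≤n+n = ℕ.≮⇒≥ (λ n<m → ℕ.<⇒≱ (ℕ.+-mono-< n<m n<m) m+m≤n+n)

  #narrow≤ : ∀ m t .{{_ : NonZero t}} → length (filter (narrow? t) (allFPFInvolutions (m + m))) ≤ 2 ^ (m + m) * t ^ m
  #narrow≤ m t = ℕ.≤-trans
    (length-≤-by-injection code {xs = narrow} (Unique.filter⁺ (narrow? t) (allFPFInvolutions-unique (m + m))) code∈
      (λ π∈ π′∈ → code-injective (proj₁ (narrow⁻ π∈)) (proj₁ (narrow⁻ π′∈))))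
    (subst (λ l → length (sparseWords (upTo t) (m + m) m) ≤ 2 ^ (m + m) * l ^ m) (List.length-upTo t)
      (length-sparseWords (upTo t) {{subst NonZero (sym (List.length-upTo t)) it}} (m + m) m))
    where
    narrow : List (Vec (Fin (m + m)) (m + m))
    narrow = filter (narrow? t) (allFPFInvolutions (m + m))
    narrow⁻ : ∀ {π} → π ∈ narrow → IsFPFInvolution π × Narrow t π
    narrow⁻ π∈ = map₁ ∈-allFPFInvolutions⁻ (∈-filter⁻ (narrow? t) {xs = allFPFInvolutions (m + m)} π∈)
    code∈ : ∀ {π} → π ∈ narrow → code π ∈ sparseWords (upTo t) (m + m) m
    code∈ {π} π∈ = subst (λ len → code π ∈ sparseWords (upTo t) len m) (List.length-tabulate (codeEntry π))
      (∈-sparseWords (code π) few-closers (All.All-catMaybes⁺ (All.tabulate⁺ (codeEntry-bounded (proj₂ (narrow⁻ π∈))))))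
      where
      open FPF π (proj₁ (narrow⁻ π∈))
      few-closers : length (catMaybes (code π)) ≤ m
      few-closers = ℕ.≤-trans (length-catMaybes-tabulate (closes? π) (codeEntry π) (λ j → codeEntry-¬closes π))
                              (m+m≤n+n⇒m≤n closers-half)

module Matchings where
  open import Data.Fin as Fin using (Fin; zero; suc; _↑ˡ_; _↑ʳ_; splitAt; join; remQuot; combine)
  import Data.Fin.Properties as Fin
  open import Data.Fin.Permutation as Perm using (Permutation′; _⟨$⟩ʳ_; _⟨$⟩ˡ_; insert; inverseˡ; inverseʳ)
  open import Data.List using (length)
  import Data.List.Properties as List
  import Data.List.Relation.Unary.Unique.Propositional.Properties as Unique
  open import Data.Nat using (zero; suc; _≤_; _*_; _+_; _!)
  open import Data.Product using (_×_; _,_; uncurry)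
  open import Data.Sum using (_⊎_; inj₁; inj₂; [_,_]′)
  open import Data.Vec using (Vec; lookup; tabulate)
  import Data.Vec.Properties as Vec
  open import Function using (_∘_)
  open import Relation.Binary.PropositionalEquality using (_≡_; _≢_; refl; sym; trans; cong; cong₂; subst; module ≡-Reasoning)

  open Enumeration

  lehmer : ∀ m → Fin (m !) → Permutation′ m
  lehmer zero    _ = Perm.id
  lehmer (suc m) x = let (c , r) = remQuot {suc m} (m !) x in insert zero c (lehmer m r)

  remQuot-injective : ∀ {n} k {x y : Fin (n * k)} → remQuot {n} k x ≡ remQuot k y → x ≡ y
  remQuot-injective {n} k {x} {y} eq =
    trans (sym (Fin.combine-remQuot {n} k x)) (trans (cong (uncurry combine) eq) (Fin.combine-remQuot {n} k y))

  insert-injective : ∀ {m} {c c′ : Fin (suc m)} {σ σ′ : Permutation′ m} →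
    (∀ i → insert zero c σ ⟨$⟩ʳ i ≡ insert zero c′ σ′ ⟨$⟩ʳ i) → c ≡ c′ × (∀ k → σ ⟨$⟩ʳ k ≡ σ′ ⟨$⟩ʳ k)
  insert-injective {c = c} {σ = σ} {σ′} eq with eq zero
  ... | refl = refl , λ k → Fin.punchIn-injective c _ _
                 (trans (sym (Perm.insert-punchIn zero c σ k)) (trans (eq (suc k)) (Perm.insert-punchIn zero c σ′ k)))

  lehmer-injective : ∀ m {x y} → (∀ i → lehmer m x ⟨$⟩ʳ i ≡ lehmer m y ⟨$⟩ʳ i) → x ≡ y
  lehmer-injective zero    {zero} {zero} _ = refl
  lehmer-injective (suc m) x≗y = let (c≡c′ , σ≗σ′) = insert-injective x≗y in
    remQuot-injective (m !) (cong₂ _,_ c≡c′ (lehmer-injective m σ≗σ′))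

  module Pairing {m} (σ : Permutation′ m) where
    crossOver : Fin m ⊎ Fin m → Fin m ⊎ Fin m
    crossOver = [ inj₂ ∘ (σ ⟨$⟩ʳ_) , inj₁ ∘ (σ ⟨$⟩ˡ_) ]′

    crossOver-involutive : ∀ s → crossOver (crossOver s) ≡ s
    crossOver-involutive (inj₁ i) = cong inj₁ (inverseˡ σ)
    crossOver-involutive (inj₂ k) = cong inj₂ (inverseʳ σ)

    crossOver-fixfree : ∀ s → crossOver s ≢ s
    crossOver-fixfree (inj₁ _) ()
    crossOver-fixfree (inj₂ _) ()

    pairing : Fin (m + m) → Fin (m + m)
    pairing = join m m ∘ crossOver ∘ splitAt m

    splitAt-pairing : ∀ x → splitAt m (pairing x) ≡ crossOver (splitAt m x)
    splitAt-pairing x = Fin.splitAt-join m m (crossOver (splitAt m x))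

    pairing-involutive : ∀ x → pairing (pairing x) ≡ x
    pairing-involutive x = trans (cong (join m m ∘ crossOver) (splitAt-pairing x))
                                 (trans (cong (join m m) (crossOver-involutive (splitAt m x))) (Fin.join-splitAt m m x))

    pairing-fixfree : ∀ x → pairing x ≢ x
    pairing-fixfree x eq = crossOver-fixfree (splitAt m x) (trans (sym (splitAt-pairing x)) (cong (splitAt m) eq))

    pairing-left : ∀ i → pairing (i ↑ˡ m) ≡ m ↑ʳ (σ ⟨$⟩ʳ i)
    pairing-left i = cong (join m m ∘ crossOver) (Fin.splitAt-↑ˡ m i m)

  matching : ∀ {m} → Permutation′ m → Vec (Fin (m + m)) (m + m)
  matching σ = tabulate (Pairing.pairing σ)

  matching-isFPFInvolution : ∀ {m} (σ : Permutation′ m) → IsFPFInvolution (matching σ)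
  matching-isFPFInvolution σ =
    (λ x → trans (lookup-matching (lookup (matching σ) x)) (trans (cong pairing (lookup-matching x)) (pairing-involutive x))) ,
    (λ x → pairing-fixfree x ∘ trans (sym (lookup-matching x)))
    where
    open Pairing σ
    lookup-matching : ∀ x → lookup (matching σ) x ≡ pairing x
    lookup-matching = Vec.lookup∘tabulate pairing

  matching-injective : ∀ {m} {σ σ′ : Permutation′ m} → matching σ ≡ matching σ′ → ∀ i → σ ⟨$⟩ʳ i ≡ σ′ ⟨$⟩ʳ i
  matching-injective {m} {σ} {σ′} eq i = Fin.↑ʳ-injective m _ _ (begin
    m ↑ʳ (σ ⟨$⟩ʳ i)                   ≡⟨ sym (Pairing.pairing-left σ i) ⟩
    Pairing.pairing σ (i ↑ˡ m)         ≡⟨ sym (Vec.lookup∘tabulate _ (i ↑ˡ m)) ⟩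
    lookup (matching σ) (i ↑ˡ m)       ≡⟨ cong (λ v → lookup v (i ↑ˡ m)) eq ⟩
    lookup (matching σ′) (i ↑ˡ m)      ≡⟨ Vec.lookup∘tabulate _ (i ↑ˡ m) ⟩
    Pairing.pairing σ′ (i ↑ˡ m)        ≡⟨ Pairing.pairing-left σ′ i ⟩
    m ↑ʳ (σ′ ⟨$⟩ʳ i)                  ∎)
    where open ≡-Reasoning

  factorial≤#FPFInvolutions : ∀ m → m ! ≤ length (allFPFInvolutions (m + m))
  factorial≤#FPFInvolutions m = subst (_≤ length (allFPFInvolutions (m + m))) (List.length-tabulate {n = m !} (λ x → x))
    (length-≤-by-injection (matching ∘ lehmer m) (Unique.allFin⁺ (m !))
      (λ {x} _ → ∈-allFPFInvolutions (matching-isFPFInvolution (lehmer m x)))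
      (λ {x} {y} _ _ eq → lehmer-injective m (matching-injective {σ = lehmer m x} {lehmer m y} eq)))

module Estimates where
  open import Data.Nat using (ℕ; zero; suc; _≤_; _<_; _+_; _*_; _^_; _!; _/_; _%_; z≤n; s≤s; ⌊_/2⌋; ⌈_/2⌉; >-nonZero)
  import Data.Nat.Properties as ℕ
  open import Data.Nat.DivMod using (m≡m%n+[m/n]*n; m%n<n; m/n*n≤m; m≥n⇒m/n>0)
  open import Data.Nat.Induction using (<-rec)
  open import Data.Nat.Solver using (module +-*-Solver)
  open import Relation.Binary.PropositionalEquality using (_≡_; refl; sym; trans; cong; cong₂; subst)

  open +-*-Solver using (solve; _:=_; _:+_; _:*_; con)
  open ℕ.≤-Reasoning

  ^-distribʳ-* : ∀ m n o → (m * n) ^ o ≡ m ^ o * n ^ o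
  ^-distribʳ-* m n zero    = refl
  ^-distribʳ-* m n (suc o) = trans (cong (m * n *_) (^-distribʳ-* m n o))
    (solve 4 (λ m n x y → (m :* n) :* (x :* y) := (m :* x) :* (n :* y)) refl m n (m ^ o) (n ^ o))

  m+m≡m*2 : ∀ m → m + m ≡ m * 2
  m+m≡m*2 m = trans (cong (m +_) (sym (ℕ.+-identityʳ m))) (ℕ.*-comm 2 m)

  m+m≤2^m : ∀ m → m + m ≤ 2 ^ m
  m+m≤2^m zero          = z≤n
  m+m≤2^m (suc zero)    = ℕ.≤-refl
  m+m≤2^m (suc (suc m)) = begin
    suc (suc m) + suc (suc m) ≡⟨ solve 1 (λ m → (con 2 :+ m) :+ (con 2 :+ m) := ((con 1 :+ m) :+ (con 1 :+ m)) :+ con 2) refl m ⟩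
    (suc m + suc m) + 2       ≤⟨ ℕ.+-mono-≤ (m+m≤2^m (suc m)) (ℕ.^-monoʳ-≤ 2 {1} {suc m} (s≤s z≤n)) ⟩
    2 ^ suc m + 2 ^ suc m     ≡⟨ solve 1 (λ x → x :+ x := con 2 :* x) refl (2 ^ suc m) ⟩
    2 ^ suc (suc m)           ∎

  a!*[1+a]^b≤[a+b]! : ∀ a b → a ! * suc a ^ b ≤ (a + b) !
  a!*[1+a]^b≤[a+b]! a zero = ℕ.≤-reflexive (trans (ℕ.*-identityʳ _) (cong _! (sym (ℕ.+-identityʳ a))))
  a!*[1+a]^b≤[a+b]! a (suc b) = begin
    a ! * (suc a * suc a ^ b) ≡⟨ solve 3 (λ x y z → x :* (y :* z) := y :* (x :* z)) refl (a !) (suc a) (suc a ^ b) ⟩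
    suc a * (a ! * suc a ^ b) ≤⟨ ℕ.*-mono-≤ (s≤s (ℕ.m≤m+n a b)) (a!*[1+a]^b≤[a+b]! a b) ⟩
    suc (a + b) * (a + b) !   ≡⟨ cong _! (sym (ℕ.+-suc a b)) ⟩
    (a + suc b) !             ∎

  -- Splitting n into two halves a ≤ b ≤ a + 1 keeps the constant: (a + b)^(a + b) ≤ (3a)^a (2(a + 1))^b.
  n^n≤6^n*n!-halves : ∀ a b → 1 ≤ a → a ≤ b → b ≤ suc a → a ^ a ≤ 6 ^ a * a ! →
    (a + b) ^ (a + b) ≤ 6 ^ (a + b) * (a + b) !
  n^n≤6^n*n!-halves a b 1≤a a≤b b≤1+a IH = begin
    (a + b) ^ (a + b)                              ≡⟨ ℕ.^-distribˡ-+-* (a + b) a b ⟩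
    (a + b) ^ a * (a + b) ^ b                      ≤⟨ ℕ.*-mono-≤ (ℕ.^-monoˡ-≤ a a+b≤3a) (ℕ.^-monoˡ-≤ b a+b≤2[1+a]) ⟩
    (3 * a) ^ a * (2 * suc a) ^ b                  ≡⟨ cong₂ _*_ (^-distribʳ-* 3 a a) (^-distribʳ-* 2 (suc a) b) ⟩
    (3 ^ a * a ^ a) * (2 ^ b * suc a ^ b)          ≤⟨ ℕ.*-monoˡ-≤ (2 ^ b * suc a ^ b) (ℕ.*-monoʳ-≤ (3 ^ a) IH) ⟩
    (3 ^ a * (6 ^ a * a !)) * (2 ^ b * suc a ^ b)
      ≡⟨ solve 5 (λ x y z u v → (x :* (y :* z)) :* (u :* v) := ((x :* u) :* y) :* (z :* v))
               refl (3 ^ a) (6 ^ a) (a !) (2 ^ b) (suc a ^ b) ⟩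
    ((3 ^ a * 2 ^ b) * 6 ^ a) * (a ! * suc a ^ b)
      ≤⟨ ℕ.*-mono-≤ (ℕ.*-monoˡ-≤ (6 ^ a) (ℕ.*-monoˡ-≤ (2 ^ b) (ℕ.^-monoʳ-≤ 3 a≤b))) (a!*[1+a]^b≤[a+b]! a b) ⟩
    ((3 ^ b * 2 ^ b) * 6 ^ a) * (a + b) !          ≡⟨ cong (λ x → (x * 6 ^ a) * (a + b) !) (sym (^-distribʳ-* 3 2 b)) ⟩
    (6 ^ b * 6 ^ a) * (a + b) !
      ≡⟨ cong (_* (a + b) !) (trans (ℕ.*-comm (6 ^ b) (6 ^ a)) (sym (ℕ.^-distribˡ-+-* 6 a b))) ⟩
    6 ^ (a + b) * (a + b) !                        ∎
    where
    a+b≤3a : a + b ≤ 3 * a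
    a+b≤3a = begin
      a + b       ≤⟨ ℕ.+-monoʳ-≤ a (ℕ.≤-trans b≤1+a (ℕ.+-monoˡ-≤ a 1≤a)) ⟩
      a + (a + a) ≡⟨ solve 1 (λ x → x :+ (x :+ x) := con 3 :* x) refl a ⟩
      3 * a       ∎
    a+b≤2[1+a] : a + b ≤ 2 * suc a
    a+b≤2[1+a] = begin
      a + b            ≤⟨ ℕ.+-monoʳ-≤ a b≤1+a ⟩
      a + suc a        ≤⟨ ℕ.n≤1+n _ ⟩
      suc (a + suc a)  ≡⟨ solve 1 (λ x → con 1 :+ (x :+ (con 1 :+ x)) := con 2 :* (con 1 :+ x)) refl a ⟩
      2 * suc a        ∎

  ⌈n/2⌉≤1+⌊n/2⌋ : ∀ n → ⌈ n /2⌉ ≤ suc ⌊ n /2⌋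
  ⌈n/2⌉≤1+⌊n/2⌋ zero          = z≤n
  ⌈n/2⌉≤1+⌊n/2⌋ (suc zero)    = ℕ.≤-refl
  ⌈n/2⌉≤1+⌊n/2⌋ (suc (suc n)) = s≤s (⌈n/2⌉≤1+⌊n/2⌋ n)

  n^n≤6^n*n! : ∀ n → n ^ n ≤ 6 ^ n * n !
  n^n≤6^n*n! = <-rec (λ n → n ^ n ≤ 6 ^ n * n !) go
    where
    go : ∀ n → (∀ {k} → k < n → k ^ k ≤ 6 ^ k * k !) → n ^ n ≤ 6 ^ n * n !
    go zero          _  = ℕ.≤-refl
    go (suc zero)    _  = s≤s z≤n
    go (suc (suc n)) IH = subst (λ n → n ^ n ≤ 6 ^ n * n !) (ℕ.⌊n/2⌋+⌈n/2⌉≡n (suc (suc n)))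
      (n^n≤6^n*n!-halves ⌊ suc (suc n) /2⌋ ⌈ suc (suc n) /2⌉ (s≤s z≤n) (ℕ.⌊n/2⌋≤⌈n/2⌉ (suc (suc n)))
        (⌈n/2⌉≤1+⌊n/2⌋ (suc (suc n))) (IH (ℕ.⌊n/2⌋<n (suc n))))

  private
    48^m-split : ∀ m → 48 ^ m ≡ 6 ^ m * (2 ^ m * (2 ^ m * 2 ^ m))
    48^m-split m = trans (^-distribʳ-* 6 8 m) (cong (6 ^ m *_) (trans (^-distribʳ-* 2 4 m) (cong (2 ^ m *_) (^-distribʳ-* 2 2 m))))

  -- With 48 t ≤ m, the bound m^m ≤ 6^m m! leaves room for the factors m + m ≤ 2^m and 2^(m + m).
  [m+m]*[2^[m+m]*t^m]≤m! : ∀ m t → 48 * t ≤ m → (m + m) * (2 ^ (m + m) * t ^ m) ≤ m !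
  [m+m]*[2^[m+m]*t^m]≤m! m t 48t≤m = ℕ.*-cancelˡ-≤ (6 ^ m) {{>-nonZero (ℕ.m^n>0 6 m)}} (begin
    6 ^ m * ((m + m) * (2 ^ (m + m) * t ^ m))    ≤⟨ ℕ.*-monoʳ-≤ (6 ^ m) (ℕ.*-monoˡ-≤ _ (m+m≤2^m m)) ⟩
    6 ^ m * (2 ^ m * (2 ^ (m + m) * t ^ m))      ≡⟨ cong (λ x → 6 ^ m * (2 ^ m * (x * t ^ m))) (ℕ.^-distribˡ-+-* 2 m m) ⟩
    6 ^ m * (2 ^ m * ((2 ^ m * 2 ^ m) * t ^ m))
      ≡⟨ solve 4 (λ s a b u → s :* (a :* ((b :* b) :* u)) := (s :* (a :* (b :* b))) :* u) refl (6 ^ m) (2 ^ m) (2 ^ m) (t ^ m) ⟩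
    (6 ^ m * (2 ^ m * (2 ^ m * 2 ^ m))) * t ^ m ≡⟨ cong (_* t ^ m) (sym (48^m-split m)) ⟩
    48 ^ m * t ^ m                               ≡⟨ sym (^-distribʳ-* 48 t m) ⟩
    (48 * t) ^ m                                 ≤⟨ ℕ.^-monoˡ-≤ m 48t≤m ⟩
    m ^ m                                        ≤⟨ n^n≤6^n*n! m ⟩
    6 ^ m * m !                                  ∎)

  [m+m]*[2^[m+m]*t^m]^2≤[m!]^2 : ∀ m t → 1 ≤ m → 48 * t ≤ m → (m + m) * (2 ^ (m + m) * t ^ m) ^ 2 ≤ (m !) ^ 2
  [m+m]*[2^[m+m]*t^m]^2≤[m!]^2 m t 1≤m 48t≤m = begin
    (m + m) * (U * (U * 1))              ≤⟨ ℕ.*-monoʳ-≤ (m + m) (ℕ.*-monoʳ-≤ U (ℕ.*-monoʳ-≤ U 1≤m+m)) ⟩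
    (m + m) * (U * (U * (m + m)))        ≡⟨ solve 2 (λ n u → n :* (u :* (u :* n)) := (n :* u) :* ((n :* u) :* con 1)) refl (m + m) U ⟩
    ((m + m) * U) * (((m + m) * U) * 1)  ≤⟨ ℕ.*-mono-≤ U≤ (ℕ.*-monoˡ-≤ 1 U≤) ⟩
    m ! * (m ! * 1)                      ∎
    where
    U : ℕ
    U = 2 ^ (m + m) * t ^ m
    U≤ : (m + m) * U ≤ m !
    U≤ = [m+m]*[2^[m+m]*t^m]≤m! m t 48t≤m
    1≤m+m : 1 ≤ m + m
    1≤m+m = ℕ.≤-trans 1≤m (ℕ.m≤m+n m m)

  1≤m/48 : ∀ {m} → 48 ≤ m → 1 ≤ m / 48
  1≤m/48 = m≥n⇒m/n>0

  48*[m/48]≤m : ∀ m → 48 * (m / 48) ≤ m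
  48*[m/48]≤m m = subst (_≤ m) (ℕ.*-comm (m / 48) 48) (m/n*n≤m m 48)

  m+m≤[m/48]*192 : ∀ {m} → 48 ≤ m → m + m ≤ m / 48 * 192
  m+m≤[m/48]*192 {m} 48≤m =
    ℕ.≤-trans (ℕ.+-mono-≤ m≤[m/48]*96 m≤[m/48]*96) (ℕ.≤-reflexive (sym (ℕ.*-distribˡ-+ (m / 48) 96 96)))
    where
    m≤[m/48]*96 : m ≤ m / 48 * 96
    m≤[m/48]*96 = begin
      m                          ≡⟨ m≡m%n+[m/n]*n m 48 ⟩
      m % 48 + m / 48 * 48       ≤⟨ ℕ.+-monoˡ-≤ (m / 48 * 48) (ℕ.≤-trans (ℕ.<⇒≤ (m%n<n m 48)) (ℕ.*-monoˡ-≤ 48 (1≤m/48 48≤m))) ⟩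
      m / 48 * 48 + m / 48 * 48  ≡⟨ sym (ℕ.*-distribˡ-+ (m / 48) 48 48) ⟩
      m / 48 * 96                ∎

open import Level using (_⊔_)
open import Data.Fin as Fin using (Fin; toℕ)
import Data.Fin.Properties as Fin
open import Data.List using (List; length; filter)
open import Data.List.Membership.Propositional using (_∈_)
open import Data.List.Membership.Propositional.Properties using (∈-filter⁻)
open import Data.List.Relation.Unary.All as All using (All)
open import Data.List.Relation.Unary.Unique.Propositional using (Unique)
import Data.List.Relation.Unary.Unique.Propositional.Properties as Unique
open import Data.Nat using (ℕ; _≤_; _<_; _+_; _*_; _^_; _∸_; _!; _/_; _<?_; z≤n; s≤s; >-nonZero)
import Data.Nat.Properties as ℕ
open import Data.Nat.Divisibility using (_∣_; divides)
open import Data.Product using (Σ; _×_; _,_; proj₁; proj₂)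
open import Data.Vec using (Vec)
open import Function using (_∘_)
open import Relation.Nullary using (¬_)
open import Relation.Unary.Properties using (∁?)
open import Relation.Binary.PropositionalEquality using (_≡_; refl; sym; trans; cong; subst)

open Enumeration
open FinCount using (select)
open CayleyPermanent using (module CayleyFoolingSet)
open CrossingCodes
open Matchings using (factorial≤#FPFInvolutions)
open Estimates

module LowerBound {c ℓ} (F : Field c ℓ) where
  2^t≤size-of-¬narrow : ∀ {n t} {π : Vec (Fin n) n} → IsFPFInvolution π → ¬ Narrow t π →
    (A : ABP F (Var n)) → ComputesCayleyPerm F π A → 2 ^ t ≤ ABP.size A
  2^t≤size-of-¬narrow {n} {t} {π} fpf ¬narrow =
    let (J , wide) = Fin.¬∀⟶∃¬ n _ (λ J → width π (toℕ J) <? t) ¬narrow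
        (a , a-injective , a-crosses) = select (crosses? π (toℕ J)) (ℕ.≮⇒≥ wide)
    in CayleyFoolingSet.2^t≤size F π fpf (toℕ J) a a-injective (proj₁ ∘ a-crosses) (proj₂ ∘ a-crosses)

  HardInstances : ℕ → ℕ → Set (c ⊔ ℓ)
  HardInstances k n =
    Σ (List (Vec (Fin n) n)) λ good →
      Unique good
      × All IsFPFInvolution good
      × All (λ π → (A : ABP F (Var n)) → ComputesCayleyPerm F π A → 2 ^ n ≤ ABP.size A ^ k) good
      × ((length (allFPFInvolutions n) ∸ length good) ^ 2 * n ≤ length (allFPFInvolutions n) ^ 2)

  module Instances (m : ℕ) (48≤m : 48 ≤ m) where
    t : ℕ
    t = m / 48

    all wide narrow : List (Vec (Fin (m + m)) (m + m))
    all = allFPFInvolutions (m + m)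
    wide = filter (∁? (narrow? t)) all
    narrow = filter (narrow? t) all

    ∈wide⁻ : ∀ {π} → π ∈ wide → π ∈ all × ¬ Narrow t π
    ∈wide⁻ = ∈-filter⁻ (∁? (narrow? t)) {xs = all}

    size-bound : ∀ {π} → π ∈ wide → (A : ABP F (Var (m + m))) → ComputesCayleyPerm F π A → 2 ^ (m + m) ≤ ABP.size A ^ 192
    size-bound {π} π∈ A computes = begin
      2 ^ (m + m)       ≤⟨ ℕ.^-monoʳ-≤ 2 (m+m≤[m/48]*192 48≤m) ⟩
      2 ^ (t * 192)     ≡⟨ sym (ℕ.^-*-assoc 2 t 192) ⟩
      (2 ^ t) ^ 192     ≤⟨ ℕ.^-monoˡ-≤ 192 (2^t≤size-of-¬narrow fpf (proj₂ (∈wide⁻ π∈)) A computes) ⟩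
      ABP.size A ^ 192  ∎
      where
      open ℕ.≤-Reasoning
      fpf : IsFPFInvolution π
      fpf = ∈-allFPFInvolutions⁻ (proj₁ (∈wide⁻ π∈))

    #all∸#wide≡#narrow : length all ∸ length wide ≡ length narrow
    #all∸#wide≡#narrow =
      trans (cong (_∸ length wide) (sym (length-filter-∁ (narrow? t) all))) (ℕ.m+n∸n≡m (length narrow) (length wide))

    count-bound : (length all ∸ length wide) ^ 2 * (m + m) ≤ length all ^ 2
    count-bound = begin
      (length all ∸ length wide) ^ 2 * (m + m)  ≡⟨ cong (λ x → x ^ 2 * (m + m)) #all∸#wide≡#narrow ⟩
      length narrow ^ 2 * (m + m)               ≤⟨ ℕ.*-monoˡ-≤ (m + m) (ℕ.^-monoˡ-≤ 2 (#narrow≤ m t {{>-nonZero (1≤m/48 48≤m)}})) ⟩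
      (2 ^ (m + m) * t ^ m) ^ 2 * (m + m)       ≡⟨ ℕ.*-comm _ (m + m) ⟩
      (m + m) * (2 ^ (m + m) * t ^ m) ^ 2       ≤⟨ [m+m]*[2^[m+m]*t^m]^2≤[m!]^2 m t (ℕ.≤-trans (s≤s z≤n) 48≤m) (48*[m/48]≤m m) ⟩
      (m !) ^ 2                                 ≤⟨ ℕ.^-monoˡ-≤ 2 (factorial≤#FPFInvolutions m) ⟩
      length all ^ 2                            ∎
      where open ℕ.≤-Reasoning

  hard-instances : ∀ m → 48 ≤ m → HardInstances 192 (m + m)
  hard-instances m 48≤m =
    wide , Unique.filter⁺ _ (allFPFInvolutions-unique (m + m)) , All.tabulate (∈-allFPFInvolutions⁻ ∘ proj₁ ∘ ∈wide⁻) ,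
    All.tabulate size-bound , count-bound
    where open Instances m 48≤m

theorem4 : ∀ {c ℓ} (F : Field c ℓ) →
    Σ ℕ λ k → Σ ℕ λ n₀ → ∀ n → 2 ∣ n → n₀ ≤ n →
      Σ (List (Vec (Fin n) n)) λ good →
        Unique good
        × All IsFPFInvolution good
        × All (λ π → (A : ABP F (Var n)) → ComputesCayleyPerm F π A → 2 ^ n ≤ ABP.size A ^ k) good
        × ((length (allFPFInvolutions n) ∸ length good) ^ 2 * n ≤ length (allFPFInvolutions n) ^ 2)
theorem4 F = 192 , 96 , λ where
  n (divides m refl) 96≤n →
    subst (LowerBound.HardInstances F 192) (m+m≡m*2 m) (LowerBound.hard-instances F m (ℕ.*-cancelʳ-≤ 48 m 2 96≤n))
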